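{- Let $\mathbb F$ be a field with $|\mathbb F|>k$, let $n>k\ge1$ with $n+k$ odd, let $S$ be a linear map on $\mathrm{M}_{(n-1)\,k}(\mathbb F)$ and let $T = L^{+}\circ S\circ L^{ - }$, a linear map on $\mathrm{M}_{n\,k}(\mathbb F)$. Suppose there exist $A'\in\mathrm{M}_{(n-1)\,(n-1)}(\mathbb F)$ and $B'\in\mathrm{M}_{k\,k}(\mathbb F)$ with $\det_{(n-1)\,k}(A'(|d])\det_k(B') = \operatorname{sgn}(d)$ for all $k$-element subsets $d\subseteq\{1,\dots,n-1\}$, such that $S(Y)=A'YB'$ for all $Y\in\mathrm{M}_{(n-1)\,k}(\mathbb F)$. Then there exist $A\in\mathrm{M}_{n\,n}(\mathbb F)$ and $B\in\mathrm{M}_{k\,k}(\mathbb F)$ with $\det_{n\,k}(A(|d])\det_k(B)=\operatorname{sgn}(d)$ for all $k$-element subsets $d\subseteq\{1,\dots,n\}$, such that $T(X)=AXB$ for all $X\in\mathrm{M}_{n\,k}(\mathbb F)$.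
   Context: $|\mathbb F|>k$ means $\mathbb F$ is infinite or finite with more than $k$ elements. For $m \ge k$ and $X=(x_{i\,j})\in\mathrm{M}_{m\,k}(\mathbb F)$, the Cullis determinant is $\det_{m\,k}(X) = \sum_{\sigma} \operatorname{sgn}_{m\,k}(\sigma)\, x_{\sigma(1)\,1}\cdots x_{\sigma(k)\,k}$, the sum over all injections $\sigma\colon\{1,\ldots,k\}\to\{1,\ldots,m\}$, where, writing $\sigma(\{1,\dots,k\})=\{i_1<\cdots<i_k\}$, $\operatorname{sgn}_{m\,k}(\sigma)=\operatorname{sgn}(\pi_\sigma)(-1)^{\sum_{\alpha=1}^k(i_\alpha-\alpha)}$ with $\pi_\sigma$ the permutation of $\{i_1,\dots,i_k\}$ sending $i_\alpha\mapsto\sigma(\alpha)$; $\det_k=\det_{k\,k}$ is the ordinary determinant. For a $k$-element set $d=\{i_1<\dots<i_k\}$, $\operatorname{sgn}(d)=(-1)^{\sum_{\alpha=1}^k(i_\alpha-\alpha)}$, and for a square matrix $A$, $A(|d]$ is the submatrix formed by the columns with indices in $d$. For $X\in\mathrm{M}_{n\,k}(\mathbb F)$, $L^{ - }(X)\in\mathrm{M}_{(n-1)\,k}(\mathbb F)$ has $r$-th row equal to (row $r$ of $X$) minus (row $n$ of $X$), $1\le r\le n-1$. For $Y\in\mathrm{M}_{(n-1)\,k}(\mathbb F)$, $L^{+}(Y)\in\mathrm{M}_{n\,k}(\mathbb F)$ is $Y$ with a zero row adjoined as the last row. -}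

module Defs where

open import Level using (Level; _⊔_) renaming (suc to lsuc)
open import Algebra.Bundles using (CommutativeRing)
open import Data.Nat as ℕ using (ℕ; zero; suc; _∸_; _<ᵇ_; _≤_; _<_)
open import Data.Bool using (Bool; true; false; if_then_else_)
open import Data.Fin as Fin using (Fin; toℕ; inject₁; fromℕ; _≟_)
open import Data.List as List using (List; []; _∷_; concatMap; filter; allFin)
open import Data.List.Relation.Unary.Any using (any?)
open import Data.Vec as Vec using (Vec; []; _∷_; lookup)
open import Data.Product using (Σ; ∃; _×_)
open import Relation.Binary.PropositionalEquality using (_≡_)
open import Relation.Nullary using (¬_; ¬?)

record Field (c ℓ : Level) : Set (lsuc (c ⊔ ℓ)) where
  field
    commutativeRing : CommutativeRing c ℓ
  open CommutativeRing commutativeRing public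
  field
    0≉1     : ¬ (0# ≈ 1#)
    inverse : ∀ x → ¬ (x ≈ 0#) → ∃ λ y → x * y ≈ 1#

sumℕ : ∀ {n} → (Fin n → ℕ) → ℕ
sumℕ {zero}  f = 0
sumℕ {suc n} f = f Fin.zero ℕ.+ sumℕ (λ i → f (Fin.suc i))

inversions : ∀ {k m} → (Fin k → Fin m) → ℕ
inversions {k} s =
  sumℕ λ α → sumℕ λ β →
    if (toℕ α <ᵇ toℕ β) then (if (toℕ (s β) <ᵇ toℕ (s α)) then 1 else 0) else 0

injections : (k m : ℕ) → List (Vec (Fin m) k)
injections zero    m = [] ∷ []
injections (suc k) m =
  concatMap (λ v → List.map (λ i → i ∷ v)
                     (filter (λ i → ¬? (any? (i ≟_) (Vec.toList v))) (allFin m)))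
            (injections k m)

module FieldDefs {c ℓ : Level} (F : Field c ℓ) where
  open Field F public

  Mat : ℕ → ℕ → Set c
  Mat m n = Fin m → Fin n → Carrier

  _≈ₘ_ : ∀ {m n} → Mat m n → Mat m n → Set ℓ
  X ≈ₘ Y = ∀ i j → X i j ≈ Y i j

  ∑ : ∀ {n} → (Fin n → Carrier) → Carrier
  ∑ {zero}  f = 0#
  ∑ {suc n} f = f Fin.zero + ∑ (λ i → f (Fin.suc i))

  ∑ₗ : List Carrier → Carrier
  ∑ₗ = List.foldr _+_ 0#

  _⊛_ : ∀ {m l n} → Mat m l → Mat l n → Mat m n
  (A ⊛ B) i j = ∑ λ r → A i r * B r j

  _+ₘ_ : ∀ {m n} → Mat m n → Mat m n → Mat m n
  (X +ₘ Y) i j = X i j + Y i j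

  _·ₘ_ : ∀ {m n} → Carrier → Mat m n → Mat m n
  (a ·ₘ X) i j = a * X i j

  signPow : ℕ → Carrier
  signPow zero    = 1#
  signPow (suc e) = - signPow e

  -- sgn of the k-element set {s 0, …, s (k-1)} ⊆ {0,…,m-1} (0-based):
  -- (-1)^(Σ_α (i_α - α)); this only depends on the image of s.
  sgnSet : ∀ {k m} → (Fin k → Fin m) → Carrier
  sgnSet {k} s = signPow (sumℕ (λ α → toℕ (s α)) ∸ sumℕ (λ (α : Fin k) → toℕ α))

  -- sgn_{m k}(σ) = sgn(π_σ) · (-1)^(Σ_α (i_α - α)), with sgn(π_σ) computed
  -- as (-1)^(number of inversions of the sequence σ(1),…,σ(k)).
  sgnInj : ∀ {k m} → (Fin k → Fin m) → Carrier
  sgnInj σ = signPow (inversions σ) * sgnSet σ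

  detC : (m k : ℕ) → Mat m k → Carrier
  detC m k X = ∑ₗ (List.map term (injections k m))
    where
      term : Vec (Fin m) k → Carrier
      term v = sgnInj (lookup v) * List.foldr _*_ 1#
                 (List.map (λ α → X (lookup v α) α) (allFin k))

  det : (k : ℕ) → Mat k k → Carrier
  det k = detC k k

  -- k-element subsets d of {0,…,n-1}, represented by their increasing
  -- enumeration d 0 < d 1 < … < d (k-1)
  Increasing : ∀ {k n} → (Fin k → Fin n) → Set
  Increasing d = ∀ α β → α Fin.< β → d α Fin.< d β

  cols : ∀ {m n k} → Mat m n → (Fin k → Fin n) → Mat m k
  cols A d i α = A i (d α)

  L⁻ : ∀ {m k} → Mat (suc m) k → Mat m k
  L⁻ {m} X r j = X (inject₁ r) j - X (fromℕ m) j

  -- L⁺ : M_{m k} → M_{(m+1) k}, adjoin a zero last row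
  L⁺ : ∀ {m k} → Mat m k → Mat (suc m) k
  L⁺ {zero}  Y Fin.zero    j = 0#
  L⁺ {suc m} Y Fin.zero    j = Y Fin.zero j
  L⁺ {suc m} Y (Fin.suc r) j = L⁺ (λ r′ → Y (Fin.suc r′)) r j

  IsLinear : ∀ {m k} → (Mat m k → Mat m k) → Set (c ⊔ ℓ)
  IsLinear S = (∀ X Y → S (X +ₘ Y) ≈ₘ (S X +ₘ S Y))
             × (∀ a X → S (a ·ₘ X) ≈ₘ (a ·ₘ S X))

-- The witnesses are B = B′ and A = [[A′, −A′𝟙], [0, 0]] (𝟙 the all-ones column): since
-- A′ (L⁻ X) = [A′ | −A′𝟙] X, we get L⁺ (A′ (L⁻ X) B′) = A X B.
--
-- The zero last row of A reduces det_{n k}(A(|d]) to the Cullis determinant of the columns d of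
-- Â = [A′ | −A′𝟙], which is multilinear and alternating in its columns. If the last index
-- m = n − 1 is not in d, the hypothesis on A′ applies. Otherwise d = e ∪ {m}, and expanding the
-- column −A′𝟙 = −Σ_r A′(|r] gives −Σ_{r<m} det(Â(|e, r)). The terms with r ∈ e vanish; for r ∉ e,
-- moving r to its sorted position costs (−1)^#{entries of e above r}, and the resulting signs
-- alternate along the complement of e in {0, …, m − 1}. That complement has n − k elements, an
-- odd number, so the sum collapses to a single sign, which is sgn(d).

module Submission where

open import Defs
open import Level using (Level; _⊔_)
open import Data.Nat using (ℕ; suc; _≤_; _<_; _%_) renaming (_+_ to _+ℕ_)
open import Data.Fin using (Fin)
open import Data.Product using (Σ; _×_)
open import Relation.Binary.PropositionalEquality using (_≡_)

open import Algebra.Bundles using (CommutativeMonoid)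
import Algebra.Properties.CommutativeSemigroup
import Algebra.Properties.Semiring.Sum
import Algebra.Solver.CommutativeMonoid
open import Data.Fin as Fin using (zero; suc; toℕ; inject₁; fromℕ)
import Data.Fin.Properties as Fin
open import Data.Fin.Relation.Unary.Top using (view; ‵fromℕ; ‵inject₁)
open import Data.Nat as ℕ using (zero; _∸_; z≤n; s≤s)
import Data.Nat.Properties as ℕ
open import Data.Product using (∃; _,_)
open import Data.Sum using (inj₁; inj₂)
open import Function using (_∘_; _$_)
open import Relation.Binary.PropositionalEquality as ≡ using (_≗_; _≢_)
open import Relation.Nullary using (Dec; yes; no; contradiction)

module Sequences where
  open ≡ using (refl)
  open import Data.Vec.Functional using (Vector; head; tail; insertAt)
  open Algebra.Properties.CommutativeSemigroup ℕ.+-commutativeSemigroup using (x∙yz≈y∙xz)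

  private variable
    a : Level
    A : Set a
    n M : ℕ

  adjSwap : Fin n → Fin (suc n) → Fin (suc n)
  adjSwap zero    zero          = suc zero
  adjSwap zero    (suc zero)    = zero
  adjSwap zero    (suc (suc β)) = suc (suc β)
  adjSwap (suc α) zero          = zero
  adjSwap (suc α) (suc β)       = suc (adjSwap α β)

  adjSwap-repeated : (s : Vector A (suc n)) (α : Fin n) → s (inject₁ α) ≡ s (suc α) → s ∘ adjSwap α ≗ s
  adjSwap-repeated s zero    eq zero          = ≡.sym eq
  adjSwap-repeated s zero    eq (suc zero)    = eq
  adjSwap-repeated s zero    eq (suc (suc β)) = refl
  adjSwap-repeated s (suc α) eq zero          = refl
  adjSwap-repeated s (suc α) eq (suc β)       = adjSwap-repeated (tail s) α eq β

  _∷ʳ_ : Vector A n → A → Vector A (suc n)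
  xs ∷ʳ x = insertAt xs (fromℕ _) x

  ∷ʳ-inject₁ : (xs : Vector A n) (x : A) (i : Fin n) → (xs ∷ʳ x) (inject₁ i) ≡ xs i
  ∷ʳ-inject₁ xs x zero    = refl
  ∷ʳ-inject₁ xs x (suc i) = ∷ʳ-inject₁ (tail xs) x i

  ∷ʳ-fromℕ : (xs : Vector A n) (x : A) → (xs ∷ʳ x) (fromℕ n) ≡ x
  ∷ʳ-fromℕ {n = zero}  xs x = refl
  ∷ʳ-fromℕ {n = suc n} xs x = ∷ʳ-fromℕ (tail xs) x

  ∷ʳ-ext : (xs : Vector A n) (x : A) (t : Vector A (suc n)) →
           (∀ i → xs i ≡ t (inject₁ i)) → x ≡ t (fromℕ n) → xs ∷ʳ x ≗ t
  ∷ʳ-ext xs x t xs≡ x≡ i with view i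
  ... | ‵fromℕ     = ≡.trans (∷ʳ-fromℕ xs x) x≡
  ... | ‵inject₁ j = ≡.trans (∷ʳ-inject₁ xs x j) (xs≡ j)

  insertAt-inject₁-suc : (xs : Vector A n) (x : A) (i : Fin n) → insertAt xs (inject₁ i) x (suc i) ≡ xs i
  insertAt-inject₁-suc xs x zero    = refl
  insertAt-inject₁-suc xs x (suc i) = insertAt-inject₁-suc (tail xs) x i

  insertAt-all : (P : A → Set) (xs : Vector A n) (p : Fin (suc n)) (x : A) →
                 (∀ i → P (xs i)) → P x → ∀ j → P (insertAt xs p x j)
  insertAt-all P xs zero    x all-xs px zero    = px
  insertAt-all P xs zero    x all-xs px (suc j) = all-xs j
  insertAt-all {n = suc n} P xs (suc p) x all-xs px zero    = all-xs zero
  insertAt-all {n = suc n} P xs (suc p) x all-xs px (suc j) =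
    insertAt-all P (tail xs) p x (all-xs ∘ suc) px j

  sumℕ-cong : {f g : Fin n → ℕ} → (∀ i → f i ≡ g i) → sumℕ f ≡ sumℕ g
  sumℕ-cong {n = zero}  f≡g = refl
  sumℕ-cong {n = suc n} f≡g = ≡.cong₂ _+ℕ_ (f≡g zero) (sumℕ-cong (f≡g ∘ suc))

  sumℕ-insertAt : (f : A → ℕ) (xs : Vector A n) (p : Fin (suc n)) (x : A) →
                  sumℕ (f ∘ insertAt xs p x) ≡ f x +ℕ sumℕ (f ∘ xs)
  sumℕ-insertAt f xs zero x = refl
  sumℕ-insertAt {n = suc n} f xs (suc p) x = begin
    f (head xs) +ℕ sumℕ (f ∘ insertAt (tail xs) p x)
      ≡⟨ ≡.cong (f (head xs) +ℕ_) (sumℕ-insertAt f (tail xs) p x) ⟩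
    f (head xs) +ℕ (f x +ℕ sumℕ (f ∘ tail xs))
      ≡⟨ x∙yz≈y∙xz (f (head xs)) (f x) _ ⟩
    f x +ℕ sumℕ (f ∘ xs)
      ∎
    where open ≡.≡-Reasoning

  lowerAll : {m : ℕ} (s : Vector (Fin (suc m)) n) → (∀ i → toℕ (s i) < m) → Vector (Fin m) n
  lowerAll s s<m i = Fin.lower₁ (s i) (ℕ.<⇒≢ (s<m i) ∘ ≡.sym)

  toℕ-lowerAll : {m : ℕ} (s : Vector (Fin (suc m)) n) (s<m : ∀ i → toℕ (s i) < m) →
                 ∀ i → toℕ (lowerAll s s<m i) ≡ toℕ (s i)
  toℕ-lowerAll s s<m i = Fin.toℕ-lower₁ (s i) _

  inject₁-lowerAll : {m : ℕ} (s : Vector (Fin (suc m)) n) (s<m : ∀ i → toℕ (s i) < m) →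
                     ∀ i → inject₁ (lowerAll s s<m i) ≡ s i
  inject₁-lowerAll s s<m i = Fin.inject₁-lower₁ (s i) _

  insertionIndex : ℕ → Vector (Fin M) n → Fin (suc n)
  insertionIndex {n = zero}  x e = zero
  insertionIndex {n = suc n} x e with toℕ (head e) ℕ.<? x
  ... | yes _ = suc (insertionIndex x (tail e))
  ... | no _  = zero

  insertionIndex-≤head : (e : Vector (Fin M) n) {x : ℕ} → (∀ α → x ≤ toℕ (e α)) →
                         insertionIndex x e ≡ zero
  insertionIndex-≤head {n = zero}  e x≤ = refl
  insertionIndex-≤head {n = suc n} e {x} x≤ with toℕ (head e) ℕ.<? x
  ... | yes h<x = contradiction (x≤ zero) (ℕ.<⇒≱ h<x)
  ... | no _    = refl

  insertionIndex-above : (e : Vector (Fin M) n) {x : ℕ} → (∀ α → toℕ (e α) < x) →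
                         insertionIndex x e ≡ fromℕ n
  insertionIndex-above {n = zero}  e <x = refl
  insertionIndex-above {n = suc n} e {x} <x with toℕ (head e) ℕ.<? x
  ... | yes _  = ≡.cong suc (insertionIndex-above (tail e) (<x ∘ suc))
  ... | no h≮x = contradiction (<x zero) h≮x

  insertionIndex-suc-miss : (e : Vector (Fin M) n) {x : ℕ} → (∀ α → toℕ (e α) ≢ x) →
                            insertionIndex (suc x) e ≡ insertionIndex x e
  insertionIndex-suc-miss {n = zero}  e miss = refl
  insertionIndex-suc-miss {n = suc n} e {x} miss with toℕ (head e) ℕ.<? suc x | toℕ (head e) ℕ.<? x
  ... | yes _     | yes _   = ≡.cong suc (insertionIndex-suc-miss (tail e) (miss ∘ suc))
  ... | yes h<1+x | no h≮x  = contradiction (ℕ.≤-antisym (ℕ.s≤s⁻¹ h<1+x) (ℕ.≮⇒≥ h≮x)) (miss zero)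
  ... | no h≮1+x  | yes h<x = contradiction (ℕ.m<n⇒m<1+n h<x) h≮1+x
  ... | no _      | no _    = refl

open Sequences

module _ {c ℓ} (F : Field c ℓ) where
  open FieldDefs F hiding (zero)
  open import Algebra.Properties.Ring ring
    using (-‿distribˡ-*; -‿distribʳ-*; -‿involutive; -0#≈0#; -1*x≈-x; x[y-z]≈xy-xz)
  open import Data.Vec.Functional using (Vector; head; tail; insertAt)
  open import Data.Vec.Functional.Properties using (insertAt-lookup)
  open import Relation.Binary.Reasoning.Setoid setoid
  module Sum = Algebra.Properties.Semiring.Sum semiring

  private variable
    k n M : ℕ

  -- Increasing sequences

  Increasing-tail : {s : Vector (Fin M) (suc n)} → Increasing s → Increasing (tail s)
  Increasing-tail inc α β α<β = inc (suc α) (suc β) (s≤s α<β)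

  Increasing-head : {s : Vector (Fin M) (suc n)} → Increasing s → ∀ α → s zero Fin.< s (suc α)
  Increasing-head inc α = inc zero (suc α) (s≤s z≤n)

  Increasing-cons : (s : Vector (Fin M) (suc n)) → (∀ α → s zero Fin.< s (suc α)) →
                    Increasing (tail s) → Increasing s
  Increasing-cons s head< inc zero    (suc β) _         = head< β
  Increasing-cons s head< inc (suc α) (suc β) (s≤s α<β) = inc α β α<β

  Increasing-mono : {s : Vector (Fin M) k} → Increasing s → ∀ {α β} → α Fin.≤ β → s α Fin.≤ s β
  Increasing-mono {s = s} inc {α} {β} α≤β with ℕ.m≤n⇒m<n∨m≡n α≤β
  ... | inj₁ α<β = ℕ.<⇒≤ (inc α β α<β)
  ... | inj₂ α≡β = ℕ.≤-reflexive (≡.cong (toℕ ∘ s) (Fin.toℕ-injective α≡β))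

  Increasing-lowerAll : (s : Vector (Fin (suc M)) k) (s<M : ∀ α → toℕ (s α) < M) →
                        Increasing s → Increasing (lowerAll s s<M)
  Increasing-lowerAll s s<M inc α β α<β =
    ≡.subst₂ ℕ._<_ (≡.sym (toℕ-lowerAll s s<M α)) (≡.sym (toℕ-lowerAll s s<M β)) (inc α β α<β)

  Increasing⇒+index≤ : {s : Vector (Fin M) k} → Increasing s → ∀ {b} → (∀ α → b ≤ toℕ (s α)) →
                       ∀ α → b +ℕ toℕ α ≤ toℕ (s α)
  Increasing⇒+index≤ inc {b} b≤ zero = ≡.subst (_≤ _) (≡.sym (ℕ.+-identityʳ b)) (b≤ zero)
  Increasing⇒+index≤ {s = s} inc {b} b≤ (suc α) =
    ≡.subst (_≤ toℕ (s (suc α))) (≡.sym (ℕ.+-suc b (toℕ α)))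
      (Increasing⇒+index≤ (Increasing-tail inc) (λ β → ℕ.≤-<-trans (b≤ zero) (Increasing-head inc β)) α)

  sumℕ-index≤sumℕ : {s : Vector (Fin M) k} → Increasing s → sumℕ {k} toℕ ≤ sumℕ (toℕ ∘ s)
  sumℕ-index≤sumℕ inc = sumℕ-mono (Increasing⇒+index≤ inc (λ _ → z≤n))
    where
      sumℕ-mono : {f g : Fin n → ℕ} → (∀ i → f i ≤ g i) → sumℕ f ≤ sumℕ g
      sumℕ-mono {n = zero}  f≤g = z≤n
      sumℕ-mono {n = suc n} f≤g = ℕ.+-mono-≤ (f≤g zero) (sumℕ-mono (f≤g ∘ suc))

  insertionIndex-hit : (e : Vector (Fin M) n) → Increasing e → ∀ α →
                       insertionIndex (toℕ (e α)) e ≡ inject₁ α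
  insertionIndex-hit e inc zero with toℕ (head e) ℕ.<? toℕ (e zero)
  ... | yes h<h = contradiction h<h (ℕ.<-irrefl ≡.refl)
  ... | no _    = ≡.refl
  insertionIndex-hit e inc (suc α) with toℕ (head e) ℕ.<? toℕ (e (suc α))
  ... | yes _   = ≡.cong suc (insertionIndex-hit (tail e) (Increasing-tail inc) α)
  ... | no h≮eα = contradiction (Increasing-head inc α) h≮eα

  insertionIndex-suc-hit : (e : Vector (Fin M) n) → Increasing e → ∀ α →
                           insertionIndex (suc (toℕ (e α))) e ≡ suc α
  insertionIndex-suc-hit e inc zero with toℕ (head e) ℕ.<? suc (toℕ (e zero))
  ... | yes _    = ≡.cong suc (insertionIndex-≤head (tail e) (Increasing-head inc))
  ... | no h≮1+h = contradiction (ℕ.n<1+n _) h≮1+h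
  insertionIndex-suc-hit e inc (suc α) with toℕ (head e) ℕ.<? suc (toℕ (e (suc α)))
  ... | yes _     = ≡.cong suc (insertionIndex-suc-hit (tail e) (Increasing-tail inc) α)
  ... | no h≮1+eα = contradiction (ℕ.m<n⇒m<1+n (Increasing-head inc α)) h≮1+eα

  insert-increasing : (e : Vector (Fin M) n) → Increasing e → (r : Fin M) → (∀ α → toℕ (e α) ≢ toℕ r) →
                      Increasing (insertAt e (insertionIndex (toℕ r) e) r)
  insert-increasing {n = zero} e inc r miss zero zero ()
  insert-increasing {n = suc n} e inc r miss with toℕ (head e) ℕ.<? toℕ r
  ... | yes h<r = Increasing-cons (insertAt e (suc p) r)
                    (insertAt-all (head e Fin.<_) (tail e) p r (Increasing-head inc) h<r)
                    (insert-increasing (tail e) (Increasing-tail inc) r (miss ∘ suc))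
    where p = insertionIndex (toℕ r) (tail e)
  ... | no h≮r = Increasing-cons (insertAt e zero r) r<e inc
    where
      r<h : r Fin.< head e
      r<h = ℕ.≤∧≢⇒< (ℕ.≮⇒≥ h≮r) (miss zero ∘ ≡.sym)
      r<e : ∀ α → r Fin.< e α
      r<e zero    = r<h
      r<e (suc α) = ℕ.<-trans r<h (Increasing-head inc α)

  -- Signs and sums

  signPow-+ : ∀ a b → signPow (a +ℕ b) ≈ signPow a * signPow b
  signPow-+ zero    b = sym (*-identityˡ _)
  signPow-+ (suc a) b = trans (-‿cong (signPow-+ a b)) (-‿distribˡ-* _ _)

  signPow-square : ∀ a → signPow a * signPow a ≈ 1#
  signPow-square zero    = *-identityˡ 1#
  signPow-square (suc a) = begin
    - signPow a * - signPow a    ≈⟨ -‿distribˡ-* _ _ ⟨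
    - (signPow a * - signPow a)  ≈⟨ -‿cong (-‿distribʳ-* _ _) ⟨
    - - (signPow a * signPow a)  ≈⟨ -‿involutive _ ⟩
    signPow a * signPow a        ≈⟨ signPow-square a ⟩
    1#                           ∎

  signPow-∸ : ∀ {a b} → b ≤ a → signPow (a ∸ b) ≈ signPow a * signPow b
  signPow-∸ {a} {b} b≤a = begin
    signPow (a ∸ b)                            ≈⟨ *-identityˡ _ ⟨
    1# * signPow (a ∸ b)                       ≈⟨ *-congʳ (signPow-square b) ⟨
    (signPow b * signPow b) * signPow (a ∸ b)  ≈⟨ *-assoc _ _ _ ⟩
    signPow b * (signPow b * signPow (a ∸ b))  ≈⟨ *-congˡ (signPow-+ b (a ∸ b)) ⟨
    signPow b * signPow (b +ℕ (a ∸ b))         ≡⟨ ≡.cong (λ x → signPow b * signPow x) (ℕ.m+[n∸m]≡n b≤a) ⟩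
    signPow b * signPow a                      ≈⟨ *-comm _ _ ⟩
    signPow a * signPow b                      ∎

  signPow-odd : ∀ n → n % 2 ≡ 1 → signPow n ≈ - 1#
  signPow-odd 1             _   = refl
  signPow-odd (suc (suc n)) odd = trans (-‿involutive _) (signPow-odd n odd)

  signPow-odd-+ : ∀ a b → (a +ℕ b) % 2 ≡ 1 → signPow a ≈ - signPow b
  signPow-odd-+ a b odd = begin
    signPow a                            ≈⟨ *-identityʳ _ ⟨
    signPow a * 1#                       ≈⟨ *-congˡ (signPow-square b) ⟨
    signPow a * (signPow b * signPow b)  ≈⟨ *-assoc _ _ _ ⟨
    (signPow a * signPow b) * signPow b  ≈⟨ *-congʳ (signPow-+ a b) ⟨
    signPow (a +ℕ b) * signPow b         ≈⟨ *-congʳ (signPow-odd (a +ℕ b) odd) ⟩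
    - 1# * signPow b                     ≈⟨ -1*x≈-x _ ⟩
    - signPow b                          ∎

  alternatingSum : ℕ → Carrier
  alternatingSum zero    = 0#
  alternatingSum (suc n) = alternatingSum n + signPow n

  alternatingSum-2+ : ∀ n → alternatingSum (suc (suc n)) ≈ alternatingSum n
  alternatingSum-2+ n = begin
    (alternatingSum n + signPow n) - signPow n  ≈⟨ +-assoc _ _ _ ⟩
    alternatingSum n + (signPow n - signPow n)  ≈⟨ +-congˡ (-‿inverseʳ _) ⟩
    alternatingSum n + 0#                       ≈⟨ +-identityʳ _ ⟩
    alternatingSum n                            ∎

  alternatingSum-odd : ∀ n → n % 2 ≡ 1 → alternatingSum n ≈ 1#
  alternatingSum-odd 1             _   = +-identityˡ 1#
  alternatingSum-odd (suc (suc n)) odd = trans (alternatingSum-2+ n) (alternatingSum-odd n odd)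

  sgnSet-cong : ∀ {N} {s : Vector (Fin M) k} {t : Vector (Fin N) k} →
                (∀ α → toℕ (s α) ≡ toℕ (t α)) → sgnSet s ≡ sgnSet t
  sgnSet-cong {k = k} s≡t = ≡.cong (λ x → signPow (x ∸ sumℕ {k} toℕ)) (sumℕ-cong s≡t)

  sgnSet-increasing : {s : Vector (Fin M) k} → Increasing s →
                      sgnSet s ≈ signPow (sumℕ (toℕ ∘ s)) * signPow (sumℕ {k} toℕ)
  sgnSet-increasing inc = signPow-∸ (sumℕ-index≤sumℕ inc)

  ∑≈sum : (f : Fin n → Carrier) → ∑ f ≈ Sum.sum f
  ∑≈sum {zero}  f = refl
  ∑≈sum {suc n} f = +-congˡ (∑≈sum (f ∘ suc))

  ∑-cong : {f g : Fin n → Carrier} → (∀ i → f i ≈ g i) → ∑ f ≈ ∑ g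
  ∑-cong {f = f} {g} f≈g = trans (∑≈sum f) (trans (Sum.sum-cong-≋ f≈g) (sym (∑≈sum g)))

  ∑-0 : ∑ {n} (λ _ → 0#) ≈ 0#
  ∑-0 {n} = trans (∑≈sum {n} (λ _ → 0#)) (Sum.sum-replicate-zero n)

  ∑-+ : (f g : Fin n → Carrier) → ∑ (λ i → f i + g i) ≈ ∑ f + ∑ g
  ∑-+ f g = trans (∑≈sum (λ i → f i + g i)) (trans (Sum.∑-distrib-+ f g) (sym (+-cong (∑≈sum f) (∑≈sum g))))

  ∑-*ˡ : ∀ a (f : Fin n → Carrier) → a * ∑ f ≈ ∑ (λ i → a * f i)
  ∑-*ˡ a f = trans (*-congˡ (∑≈sum f)) (trans (Sum.*-distribˡ-sum a f) (sym (∑≈sum (λ i → a * f i))))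

  ∑-*ʳ : ∀ a (f : Fin n → Carrier) → ∑ f * a ≈ ∑ (λ i → f i * a)
  ∑-*ʳ a f = trans (*-congʳ (∑≈sum f)) (trans (Sum.*-distribʳ-sum a f) (sym (∑≈sum (λ i → f i * a))))

  ∑-neg : (f : Fin n → Carrier) → ∑ (λ i → - f i) ≈ - ∑ f
  ∑-neg f = begin
    ∑ (λ i → - f i)       ≈⟨ ∑-cong (λ i → -1*x≈-x (f i)) ⟨
    ∑ (λ i → - 1# * f i)  ≈⟨ ∑-*ˡ (- 1#) f ⟨
    - 1# * ∑ f            ≈⟨ -1*x≈-x _ ⟩
    - ∑ f                 ∎

  ∑-comm : ∀ {m} (f : Fin m → Fin n → Carrier) → ∑ (λ i → ∑ (f i)) ≈ ∑ (λ j → ∑ (λ i → f i j))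
  ∑-comm f = trans (∑∑≈sum f) (trans (Sum.∑-comm f) (sym (∑∑≈sum (λ j i → f i j))))
    where
      ∑∑≈sum : ∀ {m n} (g : Fin m → Fin n → Carrier) → ∑ (λ i → ∑ (g i)) ≈ Sum.sum (λ i → Sum.sum (g i))
      ∑∑≈sum g = trans (∑≈sum (λ i → ∑ (g i))) (Sum.sum-cong-≋ (λ i → ∑≈sum (g i)))

  ∑-last : (f : Fin (suc n) → Carrier) → ∑ f ≈ ∑ (f ∘ inject₁) + f (fromℕ n)
  ∑-last f = trans (∑≈sum f) (trans (Sum.sum-init-last f) (sym (+-congʳ (∑≈sum (f ∘ inject₁)))))

  module CullisDeterminant where
    open import Data.Bool using (Bool; true; false; if_then_else_; not; _∧_; _∨_)
    import Data.Bool.Properties as Bool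
    open import Data.List as List using (List; []; _∷_; _++_)
    import Data.List.Properties as List
    open import Data.List.Relation.Unary.Any using (any?)
    open import Data.Vec as Vec using (Vec; []; _∷_; lookup)
    open import Function using (mk⇔)
    open import Relation.Binary.Definitions using (tri<; tri≈; tri>)
    open import Relation.Nullary using (does; ¬?)
    open import Relation.Nullary.Decidable using (dec-true; dec-false; does-⇔)
    open import Relation.Unary using (Decidable)
    open Algebra.Properties.CommutativeSemigroup *-commutativeSemigroup using (x∙yz≈y∙xz)
    module ∨ = Algebra.Properties.CommutativeSemigroup
                 (CommutativeMonoid.commutativeSemigroup Bool.∨-commutativeMonoid)
    module + = Algebra.Properties.CommutativeSemigroup ℕ.+-commutativeSemigroup

    private variable
      m : ℕ

    ∑ᵥ : ∀ k → (Vec (Fin m) k → Carrier) → Carrier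
    ∑ᵥ zero    g = g []
    ∑ᵥ (suc k) g = ∑ᵥ k (λ v → ∑ (λ i → g (i ∷ v)))

    ∑ᵥ-cong : ∀ k {g h : Vec (Fin m) k → Carrier} → (∀ v → g v ≈ h v) → ∑ᵥ k g ≈ ∑ᵥ k h
    ∑ᵥ-cong zero    g≈h = g≈h []
    ∑ᵥ-cong (suc k) g≈h = ∑ᵥ-cong k (λ v → ∑-cong (λ i → g≈h (i ∷ v)))

    ∑ᵥ-+ : ∀ k (g h : Vec (Fin m) k → Carrier) → ∑ᵥ k (λ v → g v + h v) ≈ ∑ᵥ k g + ∑ᵥ k h
    ∑ᵥ-+ zero    g h = refl
    ∑ᵥ-+ (suc k) g h = trans (∑ᵥ-cong k (λ v → ∑-+ (λ i → g (i ∷ v)) (λ i → h (i ∷ v)))) (∑ᵥ-+ k _ _)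

    ∑ᵥ-neg : ∀ k (g : Vec (Fin m) k → Carrier) → ∑ᵥ k (λ v → - g v) ≈ - ∑ᵥ k g
    ∑ᵥ-neg zero    g = refl
    ∑ᵥ-neg (suc k) g = trans (∑ᵥ-cong k (λ v → ∑-neg (λ i → g (i ∷ v)))) (∑ᵥ-neg k _)

    ∑ᵥ-*ˡ : ∀ k (a : Carrier) (g : Vec (Fin m) k → Carrier) → a * ∑ᵥ k g ≈ ∑ᵥ k (λ v → a * g v)
    ∑ᵥ-*ˡ zero    a g = refl
    ∑ᵥ-*ˡ (suc k) a g = trans (∑ᵥ-*ˡ k a _) (∑ᵥ-cong k (λ v → ∑-*ˡ a (λ i → g (i ∷ v))))

    ∑ᵥ-∑ : ∀ {N} k (g : Fin N → Vec (Fin m) k → Carrier) →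
           ∑ᵥ k (λ v → ∑ (λ r → g r v)) ≈ ∑ (λ r → ∑ᵥ k (g r))
    ∑ᵥ-∑ zero    g = refl
    ∑ᵥ-∑ (suc k) g =
      trans (∑ᵥ-cong k (λ v → ∑-comm (λ i r → g r (i ∷ v)))) (∑ᵥ-∑ k (λ r v → ∑ (λ i → g r (i ∷ v))))

    swapᵥ : ∀ {A : Set} {k} → Fin k → Vec A (suc k) → Vec A (suc k)
    swapᵥ zero    (a ∷ b ∷ v) = b ∷ a ∷ v
    swapᵥ (suc α) (a ∷ v)     = a ∷ swapᵥ α v

    ∑ᵥ-swapᵥ : ∀ k (α : Fin k) (g : Vec (Fin m) (suc k) → Carrier) → ∑ᵥ (suc k) g ≈ ∑ᵥ (suc k) (g ∘ swapᵥ α)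
    ∑ᵥ-swapᵥ (suc k) zero    g = ∑ᵥ-cong k (λ w → ∑-comm (λ j i → g (i ∷ j ∷ w)))
    ∑ᵥ-swapᵥ (suc k) (suc α) g = ∑ᵥ-swapᵥ k α (λ v → ∑ (λ i → g (i ∷ v)))

    ∑ᵥ-inject₁ : ∀ k (g : Vec (Fin (suc m)) k → Carrier) → (∀ v β → lookup v β ≡ fromℕ m → g v ≈ 0#) →
                 ∑ᵥ k g ≈ ∑ᵥ k (g ∘ Vec.map inject₁)
    ∑ᵥ-inject₁ zero g g≈0 = refl
    ∑ᵥ-inject₁ {m} (suc k) g g≈0 = trans (∑ᵥ-cong k drop-last) (∑ᵥ-inject₁ k _ g′≈0)
      where
        drop-last : ∀ v → ∑ (λ i → g (i ∷ v)) ≈ ∑ (λ i → g (inject₁ i ∷ v))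
        drop-last v =
          trans (∑-last (λ i → g (i ∷ v))) (trans (+-congˡ (g≈0 (fromℕ m ∷ v) zero ≡.refl)) (+-identityʳ _))
        g′≈0 : ∀ v β → lookup v β ≡ fromℕ m → ∑ (λ i → g (inject₁ i ∷ v)) ≈ 0#
        g′≈0 v β vβ≡m = trans (∑-cong (λ i → g≈0 (inject₁ i ∷ v) (suc β) vβ≡m)) (∑-0 {m})

    ∑ₗ-++ : (xs ys : List Carrier) → ∑ₗ (xs ++ ys) ≈ ∑ₗ xs + ∑ₗ ys
    ∑ₗ-++ []       ys = sym (+-identityˡ _)
    ∑ₗ-++ (x ∷ xs) ys = trans (+-congˡ (∑ₗ-++ xs ys)) (sym (+-assoc _ _ _))

    ∑ₗ-concatMap : {A B : Set} (G : B → Carrier) (h : A → List B) (xs : List A) →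
                   ∑ₗ (List.map G (List.concatMap h xs)) ≈ ∑ₗ (List.map (λ a → ∑ₗ (List.map G (h a))) xs)
    ∑ₗ-concatMap G h []       = refl
    ∑ₗ-concatMap G h (a ∷ xs) = begin
      ∑ₗ (List.map G (h a ++ List.concatMap h xs))                   ≡⟨ ≡.cong ∑ₗ (List.map-++ G (h a) _) ⟩
      ∑ₗ (List.map G (h a) ++ List.map G (List.concatMap h xs))      ≈⟨ ∑ₗ-++ (List.map G (h a)) _ ⟩
      ∑ₗ (List.map G (h a)) + ∑ₗ (List.map G (List.concatMap h xs))  ≈⟨ +-congˡ (∑ₗ-concatMap G h xs) ⟩
      ∑ₗ (List.map G (h a)) + ∑ₗ (List.map (λ a → ∑ₗ (List.map G (h a))) xs) ∎

    ∑ₗ-filter : {A : Set} {P : A → Set} (P? : Decidable P) (f : A → Carrier) (xs : List A) →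
                ∑ₗ (List.map f (List.filter P? xs)) ≈ ∑ₗ (List.map (λ a → if does (P? a) then f a else 0#) xs)
    ∑ₗ-filter P? f []       = refl
    ∑ₗ-filter P? f (a ∷ xs) with does (P? a)
    ... | true  = +-congˡ (∑ₗ-filter P? f xs)
    ... | false = trans (∑ₗ-filter P? f xs) (sym (+-identityˡ _))

    ∑ₗ-allFin : ∀ {n} (f : Fin n → Carrier) → ∑ₗ (List.map f (List.allFin n)) ≈ ∑ f
    ∑ₗ-allFin f = trans (reflexive (≡.cong ∑ₗ (List.map-tabulate (λ i → i) f))) (∑ₗ-tabulate f)
      where
        ∑ₗ-tabulate : ∀ {n} (f : Fin n → Carrier) → ∑ₗ (List.tabulate f) ≈ ∑ f
        ∑ₗ-tabulate {zero}  f = refl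
        ∑ₗ-tabulate {suc n} f = +-congˡ (∑ₗ-tabulate (f ∘ suc))

    occurs : ∀ {k} → Fin m → Vec (Fin m) k → Bool
    occurs i v = does (any? (i Fin.≟_) (Vec.toList v))

    distinct : ∀ {k} → Vec (Fin m) k → Bool
    distinct []      = true
    distinct (i ∷ v) = distinct v ∧ not (occurs i v)

    ∑ₗ-injections : ∀ k (G : Vec (Fin m) k → Carrier) →
                    ∑ₗ (List.map G (injections k m)) ≈ ∑ᵥ k (λ v → if distinct v then G v else 0#)
    ∑ₗ-injections zero G = +-identityʳ _
    ∑ₗ-injections {m} (suc k) G = begin
      ∑ₗ (List.map G (List.concatMap extend (injections k m)))  ≈⟨ ∑ₗ-concatMap G extend (injections k m) ⟩
      ∑ₗ (List.map G′ (injections k m))                          ≈⟨ ∑ₗ-injections k G′ ⟩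
      ∑ᵥ k (λ v → if distinct v then G′ v else 0#)               ≈⟨ ∑ᵥ-cong k indicator ⟩
      ∑ᵥ (suc k) (λ v → if distinct v then G v else 0#)          ∎
      where
        fresh : Vec (Fin m) k → List (Fin m)
        fresh v = List.filter (λ i → ¬? (any? (i Fin.≟_) (Vec.toList v))) (List.allFin m)
        extend : Vec (Fin m) k → List (Vec (Fin m) (suc k))
        extend v = List.map (_∷ v) (fresh v)
        G′ : Vec (Fin m) k → Carrier
        G′ v = ∑ₗ (List.map G (extend v))
        G′-fresh : ∀ v → G′ v ≈ ∑ (λ i → if not (occurs i v) then G (i ∷ v) else 0#)
        G′-fresh v = begin
          ∑ₗ (List.map G (List.map (_∷ v) (fresh v)))
            ≡⟨ ≡.cong ∑ₗ (≡.sym (List.map-∘ (fresh v))) ⟩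
          ∑ₗ (List.map (λ i → G (i ∷ v)) (fresh v))
            ≈⟨ ∑ₗ-filter _ (λ i → G (i ∷ v)) (List.allFin m) ⟩
          ∑ₗ (List.map (λ i → if not (occurs i v) then G (i ∷ v) else 0#) (List.allFin m))
            ≈⟨ ∑ₗ-allFin (λ i → if not (occurs i v) then G (i ∷ v) else 0#) ⟩
          ∑ (λ i → if not (occurs i v) then G (i ∷ v) else 0#)
            ∎
        indicator : ∀ v → (if distinct v then G′ v else 0#)
                          ≈ ∑ (λ i → if distinct v ∧ not (occurs i v) then G (i ∷ v) else 0#)
        indicator v with distinct v
        ... | true  = G′-fresh v
        ... | false = sym (∑-0 {m})

    count< : ∀ {k} → Fin m → Vec (Fin m) k → ℕ
    count< i []      = 0
    count< i (j ∷ v) = (if toℕ j ℕ.<ᵇ toℕ i then 1 else 0) +ℕ count< i v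

    inversionsᵥ : ∀ {k} → Vec (Fin m) k → ℕ
    inversionsᵥ []      = 0
    inversionsᵥ (i ∷ v) = count< i v +ℕ inversionsᵥ v

    sumᵥ : ∀ {k} → Vec (Fin m) k → ℕ
    sumᵥ []      = 0
    sumᵥ (i ∷ v) = toℕ i +ℕ sumᵥ v

    sign : ∀ {k} → Vec (Fin m) k → Carrier
    sign {k = k} v = signPow (inversionsᵥ v) * signPow (sumᵥ v ∸ sumℕ {k} toℕ)

    ε : ∀ {k} → Vec (Fin m) k → Carrier
    ε v = if distinct v then sign v else 0#

    tailᶜ : ∀ {k} → Mat m (suc k) → Mat m k
    tailᶜ X i = X i ∘ suc

    ∏ᵥ : ∀ {k} → Mat m k → Vec (Fin m) k → Carrier
    ∏ᵥ X []      = 1#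
    ∏ᵥ X (i ∷ v) = X i zero * ∏ᵥ (tailᶜ X) v

    ∏ᵥ-cong : ∀ {k} {X Y : Mat m k} (v : Vec (Fin m) k) → X ≈ₘ Y → ∏ᵥ X v ≈ ∏ᵥ Y v
    ∏ᵥ-cong []      X≈Y = refl
    ∏ᵥ-cong (i ∷ v) X≈Y = *-cong (X≈Y i zero) (∏ᵥ-cong v (λ r β → X≈Y r (suc β)))

    detC-expand : ∀ m k (X : Mat m k) → detC m k X ≈ ∑ᵥ k (λ v → ε v * ∏ᵥ X v)
    detC-expand m k X = trans (∑ₗ-injections k _) (∑ᵥ-cong k term)
      where
        count-lookup : ∀ {k} i (v : Vec (Fin m) k) →
                       sumℕ (λ β → if toℕ (lookup v β) ℕ.<ᵇ toℕ i then 1 else 0) ≡ count< i v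
        count-lookup i []      = ≡.refl
        count-lookup i (j ∷ v) = ≡.cong (_ +ℕ_) (count-lookup i v)
        inversions-lookup : ∀ {k} (v : Vec (Fin m) k) → inversions (lookup v) ≡ inversionsᵥ v
        inversions-lookup []      = ≡.refl
        inversions-lookup (i ∷ v) = ≡.cong₂ _+ℕ_ (count-lookup i v) (inversions-lookup v)
        sum-lookup : ∀ {k} (v : Vec (Fin m) k) → sumℕ (toℕ ∘ lookup v) ≡ sumᵥ v
        sum-lookup []      = ≡.refl
        sum-lookup (i ∷ v) = ≡.cong (toℕ i +ℕ_) (sum-lookup v)
        product-lookup : ∀ {k} (X : Mat m k) (v : Vec (Fin m) k) →
                         List.foldr _*_ 1# (List.tabulate (λ α → X (lookup v α) α)) ≈ ∏ᵥ X v
        product-lookup X []      = refl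
        product-lookup X (i ∷ v) = *-congˡ (product-lookup (tailᶜ X) v)
        product : Vec (Fin m) k → Carrier
        product v = List.foldr _*_ 1# (List.map (λ α → X (lookup v α) α) (List.allFin k))
        term : ∀ v → (if distinct v then sgnInj (lookup v) * product v else 0#) ≈ ε v * ∏ᵥ X v
        term v with distinct v
        ... | false = sym (zeroˡ _)
        ... | true  = *-cong
          (reflexive (≡.cong₂ (λ a b → signPow a * signPow (b ∸ sumℕ {k} toℕ))
                              (inversions-lookup v) (sum-lookup v)))
          (trans (reflexive (≡.cong (List.foldr _*_ 1#) (List.map-tabulate (λ i → i) (λ α → X (lookup v α) α))))
                 (product-lookup X v))

    detC-cong : ∀ m k {X Y : Mat m k} → X ≈ₘ Y → detC m k X ≈ detC m k Y
    detC-cong m k {X} {Y} X≈Y = begin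
      detC m k X                 ≈⟨ detC-expand m k X ⟩
      ∑ᵥ k (λ v → ε v * ∏ᵥ X v)  ≈⟨ ∑ᵥ-cong k (λ v → *-congˡ (∏ᵥ-cong v X≈Y)) ⟩
      ∑ᵥ k (λ v → ε v * ∏ᵥ Y v)  ≈⟨ detC-expand m k Y ⟨
      detC m k Y                 ∎

    lookup-swapᵥ-inject₁ : ∀ {A : Set} {k} (α : Fin k) (v : Vec A (suc k)) →
                           lookup (swapᵥ α v) (inject₁ α) ≡ lookup v (suc α)
    lookup-swapᵥ-inject₁ zero    (a ∷ b ∷ v) = ≡.refl
    lookup-swapᵥ-inject₁ (suc α) (a ∷ v)     = lookup-swapᵥ-inject₁ α v

    lookup-swapᵥ-suc : ∀ {A : Set} {k} (α : Fin k) (v : Vec A (suc k)) →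
                       lookup (swapᵥ α v) (suc α) ≡ lookup v (inject₁ α)
    lookup-swapᵥ-suc zero    (a ∷ b ∷ v) = ≡.refl
    lookup-swapᵥ-suc (suc α) (a ∷ v)     = lookup-swapᵥ-suc α v

    swapᵥ-involutive : ∀ {A : Set} {k} (α : Fin k) (v : Vec A (suc k)) → swapᵥ α (swapᵥ α v) ≡ v
    swapᵥ-involutive zero    (a ∷ b ∷ v) = ≡.refl
    swapᵥ-involutive (suc α) (a ∷ v)     = ≡.cong (a ∷_) (swapᵥ-involutive α v)

    occurs-swapᵥ : ∀ {k} (x : Fin m) (α : Fin k) (v : Vec (Fin m) (suc k)) → occurs x (swapᵥ α v) ≡ occurs x v
    occurs-swapᵥ x zero    (a ∷ b ∷ w) = ∨.x∙yz≈y∙xz (does (x Fin.≟ b)) (does (x Fin.≟ a)) (occurs x w)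
    occurs-swapᵥ x (suc α) (a ∷ w)     = ≡.cong (does (x Fin.≟ a) ∨_) (occurs-swapᵥ x α w)

    distinct-swapᵥ : ∀ {k} (α : Fin k) (v : Vec (Fin m) (suc k)) → distinct (swapᵥ α v) ≡ distinct v
    distinct-swapᵥ zero (a ∷ b ∷ w) =
      ≡.trans (≡.cong (λ e → (distinct w ∧ not (occurs a w)) ∧ not (e ∨ occurs b w))
                      (does-⇔ (mk⇔ ≡.sym ≡.sym) (b Fin.≟ a) (a Fin.≟ b)))
              (exchange (distinct w) (occurs a w) (occurs b w) (does (a Fin.≟ b)))
      where
        exchange : ∀ x p q e → (x ∧ not p) ∧ not (e ∨ q) ≡ (x ∧ not q) ∧ not (e ∨ p)
        exchange false p     q     e     = ≡.refl
        exchange true  true  true  e     = ≡.refl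
        exchange true  false false e     = ≡.refl
        exchange true  true  false true  = ≡.refl
        exchange true  true  false false = ≡.refl
        exchange true  false true  true  = ≡.refl
        exchange true  false true  false = ≡.refl
    distinct-swapᵥ (suc α) (a ∷ w) = ≡.cong₂ (λ x y → x ∧ not y) (distinct-swapᵥ α w) (occurs-swapᵥ a α w)

    distinct-adjacent : ∀ {k} (α : Fin k) (v : Vec (Fin m) (suc k)) →
                        lookup v (inject₁ α) ≡ lookup v (suc α) → distinct v ≡ false
    distinct-adjacent zero    (a ∷ .a ∷ w) ≡.refl rewrite dec-true (a Fin.≟ a) ≡.refl = Bool.∧-zeroʳ _
    distinct-adjacent (suc α) (a ∷ w)      eq     rewrite distinct-adjacent α w eq = ≡.refl

    count<-swapᵥ : ∀ {k} (x : Fin m) (α : Fin k) (v : Vec (Fin m) (suc k)) → count< x (swapᵥ α v) ≡ count< x v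
    count<-swapᵥ x zero    (a ∷ b ∷ w) = +.x∙yz≈y∙xz (if toℕ b ℕ.<ᵇ toℕ x then 1 else 0) _ (count< x w)
    count<-swapᵥ x (suc α) (a ∷ w)     = ≡.cong (_ +ℕ_) (count<-swapᵥ x α w)

    sumᵥ-swapᵥ : ∀ {k} (α : Fin k) (v : Vec (Fin m) (suc k)) → sumᵥ (swapᵥ α v) ≡ sumᵥ v
    sumᵥ-swapᵥ zero    (a ∷ b ∷ w) = +.x∙yz≈y∙xz (toℕ b) (toℕ a) (sumᵥ w)
    sumᵥ-swapᵥ (suc α) (a ∷ w)     = ≡.cong (toℕ a +ℕ_) (sumᵥ-swapᵥ α w)

    inversionsᵥ-swapᵥ : ∀ {k} (α : Fin k) (v : Vec (Fin m) (suc k)) →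
                        toℕ (lookup v (inject₁ α)) < toℕ (lookup v (suc α)) →
                        inversionsᵥ (swapᵥ α v) ≡ suc (inversionsᵥ v)
    inversionsᵥ-swapᵥ zero (a ∷ b ∷ w) a<b
      rewrite dec-true (toℕ a ℕ.<? toℕ b) a<b | dec-false (toℕ b ℕ.<? toℕ a) (ℕ.<⇒≯ a<b) =
      ≡.cong suc (+.x∙yz≈y∙xz (count< b w) (count< a w) (inversionsᵥ w))
    inversionsᵥ-swapᵥ (suc α) (a ∷ w) a<b
      rewrite count<-swapᵥ a α w | inversionsᵥ-swapᵥ α w a<b = ℕ.+-suc (count< a w) (inversionsᵥ w)

    sign-swapᵥ : ∀ {k} (α : Fin k) (v : Vec (Fin m) (suc k)) → distinct v ≡ true → sign (swapᵥ α v) ≈ - sign v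
    sign-swapᵥ {k = k} α v distinct-v = begin
      signPow (inversionsᵥ (swapᵥ α v)) * signPow (sumᵥ (swapᵥ α v) ∸ T)
        ≡⟨ ≡.cong (λ x → signPow (inversionsᵥ (swapᵥ α v)) * signPow (x ∸ T)) (sumᵥ-swapᵥ α v) ⟩
      signPow (inversionsᵥ (swapᵥ α v)) * signPow (sumᵥ v ∸ T)
        ≈⟨ *-congʳ inversions-parity ⟩
      - signPow (inversionsᵥ v) * signPow (sumᵥ v ∸ T)
        ≈⟨ -‿distribˡ-* _ _ ⟨
      - sign v
        ∎
      where
        T = sumℕ {suc k} toℕ
        a = lookup v (inject₁ α)
        b = lookup v (suc α)
        inversions-parity : signPow (inversionsᵥ (swapᵥ α v)) ≈ - signPow (inversionsᵥ v)
        inversions-parity with ℕ.<-cmp (toℕ a) (toℕ b)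
        ... | tri< a<b _ _ = reflexive (≡.cong signPow (inversionsᵥ-swapᵥ α v a<b))
        ... | tri≈ _ a≡b _ =
          contradiction (≡.trans (≡.sym distinct-v) (distinct-adjacent α v (Fin.toℕ-injective a≡b))) λ ()
        ... | tri> _ _ b<a = begin
          signPow (inversionsᵥ (swapᵥ α v))      ≈⟨ -‿involutive _ ⟨
          - - signPow (inversionsᵥ (swapᵥ α v))  ≡⟨ ≡.cong (λ w → - signPow w) (≡.sym swapped-back) ⟩
          - signPow (inversionsᵥ v)              ∎
          where
            b<a′ : toℕ (lookup (swapᵥ α v) (inject₁ α)) < toℕ (lookup (swapᵥ α v) (suc α))
            b<a′ = ≡.subst₂ (λ x y → toℕ x < toℕ y)
                     (≡.sym (lookup-swapᵥ-inject₁ α v)) (≡.sym (lookup-swapᵥ-suc α v)) b<a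
            swapped-back : inversionsᵥ v ≡ suc (inversionsᵥ (swapᵥ α v))
            swapped-back = ≡.trans (≡.cong inversionsᵥ (≡.sym (swapᵥ-involutive α v)))
                                   (inversionsᵥ-swapᵥ α (swapᵥ α v) b<a′)

    ε-swapᵥ : ∀ {k} (α : Fin k) (v : Vec (Fin m) (suc k)) → ε (swapᵥ α v) ≈ - ε v
    ε-swapᵥ α v rewrite distinct-swapᵥ α v with distinct v in distinct-v
    ... | true  = sign-swapᵥ α v distinct-v
    ... | false = sym -0#≈0#

    ∏ᵥ-swapᵥ : ∀ {k} (α : Fin k) (X : Mat m (suc k)) (v : Vec (Fin m) (suc k)) →
               ∏ᵥ (λ i → X i ∘ adjSwap α) (swapᵥ α v) ≈ ∏ᵥ X v
    ∏ᵥ-swapᵥ zero    X (a ∷ b ∷ w) = x∙yz≈y∙xz _ _ _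
    ∏ᵥ-swapᵥ (suc α) X (a ∷ w)     = *-congˡ (∏ᵥ-swapᵥ α (tailᶜ X) w)

    detC-swap : ∀ m k (α : Fin k) (X : Mat m (suc k)) →
                detC m (suc k) (λ i → X i ∘ adjSwap α) ≈ - detC m (suc k) X
    detC-swap m k α X = begin
      detC m (suc k) X′
        ≈⟨ detC-expand m (suc k) X′ ⟩
      ∑ᵥ (suc k) (λ v → ε v * ∏ᵥ X′ v)
        ≈⟨ ∑ᵥ-swapᵥ k α (λ v → ε v * ∏ᵥ X′ v) ⟩
      ∑ᵥ (suc k) (λ v → ε (swapᵥ α v) * ∏ᵥ X′ (swapᵥ α v))
        ≈⟨ ∑ᵥ-cong (suc k) (λ v → *-cong (ε-swapᵥ α v) (∏ᵥ-swapᵥ α X v)) ⟩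
      ∑ᵥ (suc k) (λ v → - ε v * ∏ᵥ X v)
        ≈⟨ ∑ᵥ-cong (suc k) (λ v → -‿distribˡ-* (ε v) (∏ᵥ X v)) ⟨
      ∑ᵥ (suc k) (λ v → - (ε v * ∏ᵥ X v))
        ≈⟨ ∑ᵥ-neg (suc k) (λ v → ε v * ∏ᵥ X v) ⟩
      - ∑ᵥ (suc k) (λ v → ε v * ∏ᵥ X v)
        ≈⟨ -‿cong (detC-expand m (suc k) X) ⟨
      - detC m (suc k) X
        ∎
      where
        X′ : Mat m (suc k)
        X′ i = X i ∘ adjSwap α

    -- In characteristic 2 this does not follow from detC-swap; instead the terms whose entries α, α + 1
    -- ascend cancel against their images under swapᵥ α.
    detC-repeatedColumn : ∀ m k (α : Fin k) (X : Mat m (suc k)) → (∀ i → X i (inject₁ α) ≡ X i (suc α)) →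
                          detC m (suc k) X ≈ 0#
    detC-repeatedColumn m k α X repeated = begin
      detC m (suc k) X                                          ≈⟨ detC-expand m (suc k) X ⟩
      ∑ᵥ (suc k) f                                              ≈⟨ ∑ᵥ-cong (suc k) split ⟩
      ∑ᵥ (suc k) (λ v → ascending v + descending v)             ≈⟨ ∑ᵥ-+ (suc k) ascending descending ⟩
      ∑ᵥ (suc k) ascending + ∑ᵥ (suc k) descending              ≈⟨ +-congˡ (∑ᵥ-swapᵥ k α descending) ⟩
      ∑ᵥ (suc k) ascending + ∑ᵥ (suc k) (descending ∘ swapᵥ α)  ≈⟨ +-congˡ (∑ᵥ-cong (suc k) descending-swapᵥ) ⟩
      ∑ᵥ (suc k) ascending + ∑ᵥ (suc k) (λ v → - ascending v)   ≈⟨ +-congˡ (∑ᵥ-neg (suc k) ascending) ⟩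
      ∑ᵥ (suc k) ascending - ∑ᵥ (suc k) ascending               ≈⟨ -‿inverseʳ _ ⟩
      0#                                                        ∎
      where
        f : Vec (Fin m) (suc k) → Carrier
        f v = ε v * ∏ᵥ X v
        ascending descending : Vec (Fin m) (suc k) → Carrier
        ascending  v = if toℕ (lookup v (inject₁ α)) ℕ.<ᵇ toℕ (lookup v (suc α)) then f v else 0#
        descending v = if toℕ (lookup v (suc α)) ℕ.<ᵇ toℕ (lookup v (inject₁ α)) then f v else 0#
        split : ∀ v → f v ≈ ascending v + descending v
        split v with ℕ.<-cmp (toℕ (lookup v (inject₁ α))) (toℕ (lookup v (suc α)))
        ... | tri< a<b _ b≮a rewrite dec-true (_ ℕ.<? _) a<b | dec-false (_ ℕ.<? _) b≮a = sym (+-identityʳ _)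
        ... | tri> a≮b _ b<a rewrite dec-false (_ ℕ.<? _) a≮b | dec-true (_ ℕ.<? _) b<a = sym (+-identityˡ _)
        ... | tri≈ a≮b a≡b b≮a
          rewrite dec-false (_ ℕ.<? _) a≮b | dec-false (_ ℕ.<? _) b≮a
                | distinct-adjacent α v (Fin.toℕ-injective a≡b)
          = trans (zeroˡ _) (sym (+-identityˡ _))
        X-swap : X ≈ₘ (λ i → X i ∘ adjSwap α)
        X-swap i β = reflexive (≡.sym (adjSwap-repeated (X i) α (repeated i) β))
        f-swapᵥ : ∀ v → f (swapᵥ α v) ≈ - f v
        f-swapᵥ v = begin
          ε (swapᵥ α v) * ∏ᵥ X (swapᵥ α v)                ≈⟨ *-cong (ε-swapᵥ α v) (∏ᵥ-cong (swapᵥ α v) X-swap) ⟩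
          - ε v * ∏ᵥ (λ i → X i ∘ adjSwap α) (swapᵥ α v)  ≈⟨ *-congˡ (∏ᵥ-swapᵥ α X v) ⟩
          - ε v * ∏ᵥ X v                                  ≈⟨ -‿distribˡ-* _ _ ⟨
          - f v                                           ∎
        descending-swapᵥ : ∀ v → descending (swapᵥ α v) ≈ - ascending v
        descending-swapᵥ v rewrite lookup-swapᵥ-inject₁ α v | lookup-swapᵥ-suc α v
          with toℕ (lookup v (inject₁ α)) ℕ.<ᵇ toℕ (lookup v (suc α))
        ... | true  = f-swapᵥ v
        ... | false = sym -0#≈0#

    ∏ᵥ-linear : ∀ {k N} (γ : Fin k) (a : Fin N → Carrier) (X : Mat m k) (Y : Fin N → Mat m k) →
                (∀ i → X i γ ≈ ∑ (λ r → a r * Y r i γ)) → (∀ r i β → β ≢ γ → X i β ≈ Y r i β) →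
                ∀ v → ∏ᵥ X v ≈ ∑ (λ r → a r * ∏ᵥ (Y r) v)
    ∏ᵥ-linear {N = N} zero a X Y column others (i ∷ w) = begin
      X i zero * ∏ᵥ (tailᶜ X) w
        ≈⟨ *-congʳ (column i) ⟩
      ∑ (λ r → a r * Y r i zero) * ∏ᵥ (tailᶜ X) w
        ≈⟨ ∑-*ʳ {N} _ (λ r → a r * Y r i zero) ⟩
      ∑ (λ r → (a r * Y r i zero) * ∏ᵥ (tailᶜ X) w)
        ≈⟨ ∑-cong {n = N} (λ r → *-assoc _ _ _) ⟩
      ∑ (λ r → a r * (Y r i zero * ∏ᵥ (tailᶜ X) w))
        ≈⟨ ∑-cong {n = N} (λ r → *-congˡ (*-congˡ (∏ᵥ-cong w (λ j β → others r j (suc β) λ ())))) ⟩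
      ∑ (λ r → a r * (Y r i zero * ∏ᵥ (tailᶜ (Y r)) w))
        ∎
    ∏ᵥ-linear {N = N} (suc γ) a X Y column others (i ∷ w) = begin
      X i zero * ∏ᵥ (tailᶜ X) w
        ≈⟨ *-congˡ (∏ᵥ-linear γ a (tailᶜ X) (tailᶜ ∘ Y) column
                      (λ r j β β≢γ → others r j (suc β) (β≢γ ∘ Fin.suc-injective)) w) ⟩
      X i zero * ∑ (λ r → a r * ∏ᵥ (tailᶜ (Y r)) w)
        ≈⟨ ∑-*ˡ {N} (X i zero) (λ r → a r * ∏ᵥ (tailᶜ (Y r)) w) ⟩
      ∑ (λ r → X i zero * (a r * ∏ᵥ (tailᶜ (Y r)) w))
        ≈⟨ ∑-cong {n = N} (λ r → x∙yz≈y∙xz _ _ _) ⟩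
      ∑ (λ r → a r * (X i zero * ∏ᵥ (tailᶜ (Y r)) w))
        ≈⟨ ∑-cong {n = N} (λ r → *-congˡ (*-congʳ (others r i zero λ ()))) ⟩
      ∑ (λ r → a r * (Y r i zero * ∏ᵥ (tailᶜ (Y r)) w))
        ∎

    detC-linear : ∀ m k {N} (γ : Fin k) (a : Fin N → Carrier) (X : Mat m k) (Y : Fin N → Mat m k) →
                  (∀ i → X i γ ≈ ∑ (λ r → a r * Y r i γ)) → (∀ r i β → β ≢ γ → X i β ≈ Y r i β) →
                  detC m k X ≈ ∑ (λ r → a r * detC m k (Y r))
    detC-linear m k {N} γ a X Y column others = begin
      detC m k X
        ≈⟨ detC-expand m k X ⟩
      ∑ᵥ k (λ v → ε v * ∏ᵥ X v)
        ≈⟨ ∑ᵥ-cong k (λ v → *-congˡ (∏ᵥ-linear γ a X Y column others v)) ⟩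
      ∑ᵥ k (λ v → ε v * ∑ (λ r → a r * ∏ᵥ (Y r) v))
        ≈⟨ ∑ᵥ-cong k (λ v → trans (∑-*ˡ (ε v) (λ r → a r * ∏ᵥ (Y r) v))
                                  (∑-cong {n = N} (λ r → x∙yz≈y∙xz _ _ _))) ⟩
      ∑ᵥ k (λ v → ∑ (λ r → a r * (ε v * ∏ᵥ (Y r) v)))
        ≈⟨ ∑ᵥ-∑ k (λ r v → a r * (ε v * ∏ᵥ (Y r) v)) ⟩
      ∑ (λ r → ∑ᵥ k (λ v → a r * (ε v * ∏ᵥ (Y r) v)))
        ≈⟨ ∑-cong (λ r → trans (sym (∑ᵥ-*ˡ k (a r) _)) (*-congˡ (sym (detC-expand m k (Y r))))) ⟩
      ∑ (λ r → a r * detC m k (Y r))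
        ∎

    occurs-inject₁ : ∀ {k} (x : Fin m) (v : Vec (Fin m) k) → occurs (inject₁ x) (Vec.map inject₁ v) ≡ occurs x v
    occurs-inject₁ x []      = ≡.refl
    occurs-inject₁ x (a ∷ v) =
      ≡.cong₂ _∨_ (does-⇔ (mk⇔ Fin.inject₁-injective (≡.cong inject₁)) (inject₁ x Fin.≟ inject₁ a) (x Fin.≟ a))
                  (occurs-inject₁ x v)

    distinct-inject₁ : ∀ {k} (v : Vec (Fin m) k) → distinct (Vec.map inject₁ v) ≡ distinct v
    distinct-inject₁ []      = ≡.refl
    distinct-inject₁ (a ∷ v) = ≡.cong₂ (λ x y → x ∧ not y) (distinct-inject₁ v) (occurs-inject₁ a v)

    count<-inject₁ : ∀ {k} (x : Fin m) (v : Vec (Fin m) k) → count< (inject₁ x) (Vec.map inject₁ v) ≡ count< x v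
    count<-inject₁ x []      = ≡.refl
    count<-inject₁ x (b ∷ v) =
      ≡.cong₂ (λ p q → (if p then 1 else 0) +ℕ q) (≡.cong₂ ℕ._<ᵇ_ (Fin.toℕ-inject₁ b) (Fin.toℕ-inject₁ x))
                                                  (count<-inject₁ x v)

    inversionsᵥ-inject₁ : ∀ {k} (v : Vec (Fin m) k) → inversionsᵥ (Vec.map inject₁ v) ≡ inversionsᵥ v
    inversionsᵥ-inject₁ []      = ≡.refl
    inversionsᵥ-inject₁ (a ∷ v) = ≡.cong₂ _+ℕ_ (count<-inject₁ a v) (inversionsᵥ-inject₁ v)

    sumᵥ-inject₁ : ∀ {k} (v : Vec (Fin m) k) → sumᵥ (Vec.map inject₁ v) ≡ sumᵥ v
    sumᵥ-inject₁ []      = ≡.refl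
    sumᵥ-inject₁ (a ∷ v) = ≡.cong₂ _+ℕ_ (Fin.toℕ-inject₁ a) (sumᵥ-inject₁ v)

    ε-inject₁ : ∀ {k} (v : Vec (Fin m) k) → ε (Vec.map inject₁ v) ≡ ε v
    ε-inject₁ v rewrite distinct-inject₁ v | inversionsᵥ-inject₁ v | sumᵥ-inject₁ v = ≡.refl

    ∏ᵥ-inject₁ : ∀ {k} (X : Mat (suc m) k) (v : Vec (Fin m) k) → ∏ᵥ X (Vec.map inject₁ v) ≡ ∏ᵥ (X ∘ inject₁) v
    ∏ᵥ-inject₁ X []      = ≡.refl
    ∏ᵥ-inject₁ X (a ∷ v) = ≡.cong (X (inject₁ a) zero *_) (∏ᵥ-inject₁ (tailᶜ X) v)

    ∏ᵥ-lastRow : ∀ {k} (X : Mat (suc m) k) → (∀ β → X (fromℕ m) β ≈ 0#) →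
                 ∀ v β → lookup v β ≡ fromℕ m → ∏ᵥ X v ≈ 0#
    ∏ᵥ-lastRow X last≈0 (a ∷ v) zero    ≡.refl = trans (*-congʳ (last≈0 zero)) (zeroˡ _)
    ∏ᵥ-lastRow X last≈0 (a ∷ v) (suc β) vβ≡m  =
      trans (*-congˡ (∏ᵥ-lastRow (tailᶜ X) (last≈0 ∘ suc) v β vβ≡m)) (zeroʳ _)

    detC-zeroLastRow : ∀ m k (X : Mat (suc m) k) → (∀ β → X (fromℕ m) β ≈ 0#) →
                       detC (suc m) k X ≈ detC m k (X ∘ inject₁)
    detC-zeroLastRow m k X last≈0 = begin
      detC (suc m) k X
        ≈⟨ detC-expand (suc m) k X ⟩
      ∑ᵥ k (λ v → ε v * ∏ᵥ X v)
        ≈⟨ ∑ᵥ-inject₁ k _ (λ v β vβ≡m → trans (*-congˡ (∏ᵥ-lastRow X last≈0 v β vβ≡m)) (zeroʳ _)) ⟩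
      ∑ᵥ k (λ v → ε (Vec.map inject₁ v) * ∏ᵥ X (Vec.map inject₁ v))
        ≈⟨ ∑ᵥ-cong k (λ v → reflexive (≡.cong₂ _*_ (ε-inject₁ v) (∏ᵥ-inject₁ X v))) ⟩
      ∑ᵥ k (λ v → ε v * ∏ᵥ (X ∘ inject₁) v)
        ≈⟨ detC-expand m k (X ∘ inject₁) ⟨
      detC m k (X ∘ inject₁)
        ∎

  open CullisDeterminant using (detC-cong; detC-swap; detC-repeatedColumn; detC-linear; detC-zeroLastRow)

  -- Alternating functions of column index sequences

  record Alternating {A : Set} (g : Vector A (suc n) → Carrier) : Set (c ⊔ ℓ) where
    field
      cong     : ∀ {s t} → s ≗ t → g s ≈ g t
      swap     : ∀ α s → g (s ∘ adjSwap α) ≈ - g s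
      adjacent : ∀ α s → s (inject₁ α) ≡ s (suc α) → g s ≈ 0#

  Alternating-∘ : {A B : Set} {g : Vector A (suc n) → Carrier} → Alternating g →
                  (φ : B → A) → Alternating (λ s → g (φ ∘ s))
  Alternating-∘ alt φ = record
    { cong     = λ s≗t → cong (≡.cong φ ∘ s≗t)
    ; swap     = λ α s → swap α (φ ∘ s)
    ; adjacent = λ α s eq → adjacent α (φ ∘ s) (≡.cong φ eq)
    }
    where open Alternating alt

  module _ where
    open import Data.Vec.Functional using (_∷_)

    Alternating-∷ : {A : Set} {g : Vector A (suc (suc n)) → Carrier} → Alternating g →
                    (a : A) → Alternating (λ s → g (a ∷ s))
    Alternating-∷ alt a = record
      { cong     = λ s≗t → cong (λ { zero → ≡.refl ; (suc i) → s≗t i })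
      ; swap     = λ α s → trans (cong (λ { zero → ≡.refl ; (suc i) → ≡.refl })) (swap (suc α) (a ∷ s))
      ; adjacent = λ α s → adjacent (suc α) (a ∷ s)
      }
      where open Alternating alt

    bubble : {A : Set} {g : Vector A (suc n) → Carrier} → Alternating g →
             (e : Vector A n) (x : A) (p : Fin (suc n)) →
             g (e ∷ʳ x) ≈ signPow (n ∸ toℕ p) * g (insertAt e p x)
    bubble {n = zero}  alt e x zero = sym (*-identityˡ _)
    bubble {n = suc n} {g = g} alt e x zero = begin
      g (e ∷ʳ x)
        ≈⟨ cong (λ { zero → ≡.refl ; (suc i) → ≡.refl }) ⟩
      g (head e ∷ (tail e ∷ʳ x))
        ≈⟨ bubble (Alternating-∷ alt (head e)) (tail e) x zero ⟩
      signPow n * g (head e ∷ insertAt (tail e) zero x)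
        ≈⟨ *-congˡ (cong (λ { zero → ≡.refl ; (suc zero) → ≡.refl ; (suc (suc i)) → ≡.refl })) ⟩
      signPow n * g (insertAt e zero x ∘ adjSwap zero)
        ≈⟨ *-congˡ (swap zero (insertAt e zero x)) ⟩
      signPow n * - g (insertAt e zero x)
        ≈⟨ -‿distribʳ-* _ _ ⟨
      - (signPow n * g (insertAt e zero x))
        ≈⟨ -‿distribˡ-* _ _ ⟩
      - signPow n * g (insertAt e zero x)
        ∎
      where open Alternating alt
    bubble {n = suc n} {g = g} alt e x (suc p) = begin
      g (e ∷ʳ x)
        ≈⟨ cong (λ { zero → ≡.refl ; (suc i) → ≡.refl }) ⟩
      g (head e ∷ (tail e ∷ʳ x))
        ≈⟨ bubble (Alternating-∷ alt (head e)) (tail e) x p ⟩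
      signPow (n ∸ toℕ p) * g (head e ∷ insertAt (tail e) p x)
        ≈⟨ *-congˡ (cong (λ { zero → ≡.refl ; (suc i) → ≡.refl })) ⟩
      signPow (n ∸ toℕ p) * g (insertAt e (suc p) x)
        ∎
      where open Alternating alt

  _∈_ : ℕ → Vector (Fin M) n → Set
  x ∈ e = ∃ λ α → toℕ (e α) ≡ x

  _∈?_ : (x : ℕ) (e : Vector (Fin M) n) → Dec (x ∈ e)
  x ∈? e = Fin.any? (λ α → toℕ (e α) ℕ.≟ x)

  -- Off e, x + insertionIndex x e has the parity of the rank of x in the complement of e, so these
  -- signs alternate along that complement.
  gapSign : Vector (Fin M) n → ℕ → Carrier
  gapSign e x with x ∈? e
  ... | yes _ = 0#
  ... | no _  = signPow (x +ℕ toℕ (insertionIndex x e))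

  ∑-gapSign : (e : Vector (Fin M) n) → Increasing e → ∀ N →
              ∑ {N} (gapSign e ∘ toℕ) ≈ alternatingSum (N +ℕ toℕ (insertionIndex N e))
  ∑-gapSign e inc zero rewrite insertionIndex-≤head e {0} (λ _ → z≤n) = refl
  ∑-gapSign e inc (suc N) = begin
    ∑ {suc N} (gapSign e ∘ toℕ)
      ≈⟨ ∑-last (gapSign e ∘ toℕ) ⟩
    ∑ {N} (gapSign e ∘ toℕ ∘ inject₁) + gapSign e (toℕ (fromℕ N))
      ≈⟨ +-cong (∑-cong {n = N} (λ r → reflexive (≡.cong (gapSign e) (Fin.toℕ-inject₁ r))))
                (reflexive (≡.cong (gapSign e) (Fin.toℕ-fromℕ N))) ⟩
    ∑ {N} (gapSign e ∘ toℕ) + gapSign e N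
      ≈⟨ +-congʳ (∑-gapSign e inc N) ⟩
    alternatingSum (N +ℕ toℕ (insertionIndex N e)) + gapSign e N
      ≈⟨ step ⟩
    alternatingSum (suc N +ℕ toℕ (insertionIndex (suc N) e))
      ∎
    where
      step : alternatingSum (N +ℕ toℕ (insertionIndex N e)) + gapSign e N
             ≈ alternatingSum (suc N +ℕ toℕ (insertionIndex (suc N) e))
      step with N ∈? e
      ... | yes (α , ≡.refl)
        rewrite insertionIndex-hit e inc α | insertionIndex-suc-hit e inc α
              | Fin.toℕ-inject₁ α | ℕ.+-suc (toℕ (e α)) (toℕ α) = begin
          alternatingSum (toℕ (e α) +ℕ toℕ α) + 0#              ≈⟨ +-identityʳ _ ⟩
          alternatingSum (toℕ (e α) +ℕ toℕ α)                   ≈⟨ alternatingSum-2+ (toℕ (e α) +ℕ toℕ α) ⟨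
          alternatingSum (suc (suc (toℕ (e α) +ℕ toℕ α)))       ∎
      ... | no N∉e rewrite insertionIndex-suc-miss e (λ α eα≡N → N∉e (α , eα≡N)) = refl

  -- f plays the role of s ↦ det(Â(|s]) det B′, where column m of Â is minus the sum of the others.
  module SgnSetExtension {m K : ℕ} {f : Vector (Fin (suc m)) (suc K) → Carrier} (f-alt : Alternating f)
    (f-base : ∀ s → Increasing s → f (inject₁ ∘ s) ≈ sgnSet s)
    (f-last : ∀ e → f (e ∷ʳ fromℕ m) ≈ - ∑ (λ r → f (e ∷ʳ inject₁ r)))
    (odd : (suc m +ℕ suc K) % 2 ≡ 1)
    where

    open Alternating f-alt
    module CM = Algebra.Solver.CommutativeMonoid *-commutativeMonoid

    odd′ : (m +ℕ K) % 2 ≡ 1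
    odd′ = ≡.subst (λ x → x % 2 ≡ 1) (≡.cong suc (ℕ.+-suc m K)) odd

    f-below : Vector (Fin m) (suc K) → Carrier
    f-below s = f (inject₁ ∘ s)

    f-below-alt : Alternating f-below
    f-below-alt = Alternating-∘ f-alt inject₁

    indexSum : ℕ
    indexSum = sumℕ {suc K} toℕ

    gapFactor : Vector (Fin m) K → Carrier
    gapFactor e = signPow K * (signPow (sumℕ (toℕ ∘ e)) * signPow indexSum)

    f-below-∷ʳ-hit : (e : Vector (Fin m) K) (α : Fin K) → f-below (e ∷ʳ e α) ≈ 0#
    f-below-∷ʳ-hit e α = begin
      f-below (e ∷ʳ e α)
        ≈⟨ bubble f-below-alt e (e α) (inject₁ α) ⟩
      signPow (K ∸ toℕ (inject₁ α)) * f-below (insertAt e (inject₁ α) (e α))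
        ≈⟨ *-congˡ (Alternating.adjacent f-below-alt α _ repeated) ⟩
      signPow (K ∸ toℕ (inject₁ α)) * 0#
        ≈⟨ zeroʳ _ ⟩
      0#
        ∎
      where
        repeated : insertAt e (inject₁ α) (e α) (inject₁ α) ≡ insertAt e (inject₁ α) (e α) (suc α)
        repeated = ≡.trans (insertAt-lookup e (inject₁ α) (e α)) (≡.sym (insertAt-inject₁-suc e (e α) α))

    f-below-∷ʳ : (e : Vector (Fin m) K) → Increasing e → ∀ r →
                 f-below (e ∷ʳ r) ≈ gapFactor e * gapSign e (toℕ r)
    f-below-∷ʳ e inc r with toℕ r ∈? e
    ... | yes (α , eα≡r) rewrite ≡.sym (Fin.toℕ-injective eα≡r) = trans (f-below-∷ʳ-hit e α) (sym (zeroʳ _))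
    ... | no r∉e = begin
      f-below (e ∷ʳ r)
        ≈⟨ bubble f-below-alt e r p ⟩
      signPow (K ∸ toℕ p) * f-below (insertAt e p r)
        ≈⟨ *-cong (signPow-∸ (Fin.toℕ≤pred[n] p)) (f-base _ inc′) ⟩
      (signPow K * signPow (toℕ p)) * sgnSet (insertAt e p r)
        ≈⟨ *-congˡ (sgnSet-increasing inc′) ⟩
      (signPow K * signPow (toℕ p)) * (signPow (sumℕ (toℕ ∘ insertAt e p r)) * signPow indexSum)
        ≡⟨ ≡.cong (λ x → (signPow K * signPow (toℕ p)) * (signPow x * signPow indexSum))
                  (sumℕ-insertAt toℕ e p r) ⟩
      (signPow K * signPow (toℕ p)) * (signPow (toℕ r +ℕ sumℕ (toℕ ∘ e)) * signPow indexSum)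
        ≈⟨ *-congˡ (*-congʳ (signPow-+ (toℕ r) _)) ⟩
      (signPow K * signPow (toℕ p)) * ((signPow (toℕ r) * signPow (sumℕ (toℕ ∘ e))) * signPow indexSum)
        ≈⟨ rearrange _ _ _ _ _ ⟩
      gapFactor e * (signPow (toℕ r) * signPow (toℕ p))
        ≈⟨ *-congˡ (signPow-+ (toℕ r) (toℕ p)) ⟨
      gapFactor e * signPow (toℕ r +ℕ toℕ p)
        ∎
      where
        p = insertionIndex (toℕ r) e
        inc′ = insert-increasing e inc r (λ α eα≡r → r∉e (α , eα≡r))
        rearrange : ∀ k p r σ t → (k * p) * ((r * σ) * t) ≈ (k * (σ * t)) * (r * p)
        rearrange = CM.solve 5 (λ k p r σ t →
          (k CM.⊕ p) CM.⊕ ((r CM.⊕ σ) CM.⊕ t) CM.⊜ (k CM.⊕ (σ CM.⊕ t)) CM.⊕ (r CM.⊕ p)) refl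

    f-last-column : (e : Vector (Fin m) K) → Increasing e → f ((inject₁ ∘ e) ∷ʳ fromℕ m) ≈ - gapFactor e
    f-last-column e inc = begin
      f ((inject₁ ∘ e) ∷ʳ fromℕ m)
        ≈⟨ f-last (inject₁ ∘ e) ⟩
      - ∑ {m} (λ r → f ((inject₁ ∘ e) ∷ʳ inject₁ r))
        ≈⟨ -‿cong (∑-cong (λ r → cong (inject₁-∷ʳ r))) ⟩
      - ∑ {m} (λ r → f-below (e ∷ʳ r))
        ≈⟨ -‿cong (∑-cong (f-below-∷ʳ e inc)) ⟩
      - ∑ {m} (λ r → gapFactor e * gapSign e (toℕ r))
        ≈⟨ -‿cong (∑-*ˡ {m} (gapFactor e) _) ⟨
      - (gapFactor e * ∑ {m} (gapSign e ∘ toℕ))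
        ≈⟨ -‿cong (*-congˡ (∑-gapSign e inc m)) ⟩
      - (gapFactor e * alternatingSum (m +ℕ toℕ (insertionIndex m e)))
        ≡⟨ ≡.cong (λ x → - (gapFactor e * alternatingSum (m +ℕ x))) all-below ⟩
      - (gapFactor e * alternatingSum (m +ℕ K))
        ≈⟨ -‿cong (*-congˡ (alternatingSum-odd (m +ℕ K) odd′)) ⟩
      - (gapFactor e * 1#)
        ≈⟨ -‿cong (*-identityʳ _) ⟩
      - gapFactor e
        ∎
      where
        inject₁-∷ʳ : ∀ r → (inject₁ ∘ e) ∷ʳ inject₁ r ≗ inject₁ ∘ (e ∷ʳ r)
        inject₁-∷ʳ r = ∷ʳ-ext _ _ _ (λ i → ≡.sym (≡.cong inject₁ (∷ʳ-inject₁ e r i)))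
                                    (≡.sym (≡.cong inject₁ (∷ʳ-fromℕ e r)))
        all-below : toℕ (insertionIndex m e) ≡ K
        all-below = ≡.trans (≡.cong toℕ (insertionIndex-above e (Fin.toℕ<n ∘ e))) (Fin.toℕ-fromℕ K)

    sgnSet-last-column : (s : Vector (Fin (suc m)) (suc K)) → Increasing s → (e : Vector (Fin m) K) →
                         (inject₁ ∘ e) ∷ʳ fromℕ m ≗ s → sgnSet s ≈ - gapFactor e
    sgnSet-last-column s inc e split = begin
      sgnSet s
        ≈⟨ sgnSet-increasing inc ⟩
      signPow (sumℕ (toℕ ∘ s)) * signPow indexSum
        ≡⟨ ≡.cong (λ x → signPow x * signPow indexSum) sum-s ⟩
      signPow (m +ℕ sumℕ (toℕ ∘ e)) * signPow indexSum
        ≈⟨ *-congʳ (signPow-+ m _) ⟩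
      (signPow m * signPow (sumℕ (toℕ ∘ e))) * signPow indexSum
        ≈⟨ *-congʳ (*-congʳ (signPow-odd-+ m K odd′)) ⟩
      (- signPow K * signPow (sumℕ (toℕ ∘ e))) * signPow indexSum
        ≈⟨ *-assoc _ _ _ ⟩
      - signPow K * (signPow (sumℕ (toℕ ∘ e)) * signPow indexSum)
        ≈⟨ -‿distribˡ-* _ _ ⟨
      - gapFactor e
        ∎
      where
        sum-s : sumℕ (toℕ ∘ s) ≡ m +ℕ sumℕ (toℕ ∘ e)
        sum-s = ≡.trans (sumℕ-cong (≡.cong toℕ ∘ ≡.sym ∘ split))
                (≡.trans (sumℕ-insertAt toℕ (inject₁ ∘ e) (fromℕ K) (fromℕ m))
                         (≡.cong₂ _+ℕ_ (Fin.toℕ-fromℕ m) (sumℕ-cong (Fin.toℕ-inject₁ ∘ e))))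

    extension : ∀ s → Increasing s → f s ≈ sgnSet s
    extension s inc with toℕ (s (fromℕ K)) ℕ.≟ m
    ... | no last≢m = begin
      f s                       ≈⟨ cong (≡.sym ∘ inject₁-lowerAll s s<m) ⟩
      f-below (lowerAll s s<m)  ≈⟨ f-base _ (Increasing-lowerAll s s<m inc) ⟩
      sgnSet (lowerAll s s<m)   ≡⟨ sgnSet-cong (toℕ-lowerAll s s<m) ⟩
      sgnSet s                  ∎
      where
        s<m : ∀ α → toℕ (s α) < m
        s<m α = ℕ.≤-<-trans (Increasing-mono inc (Fin.≤fromℕ α))
                            (ℕ.≤∧≢⇒< (ℕ.s≤s⁻¹ (Fin.toℕ<n (s (fromℕ K)))) last≢m)
    ... | yes last≡m = begin
      f s                           ≈⟨ cong (≡.sym ∘ split) ⟩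
      f ((inject₁ ∘ e) ∷ʳ fromℕ m)  ≈⟨ f-last-column e inc-e ⟩
      - gapFactor e                 ≈⟨ sgnSet-last-column s inc e split ⟨
      sgnSet s                      ∎
      where
        init<m : ∀ α → toℕ (s (inject₁ α)) < m
        init<m α = ≡.subst (toℕ (s (inject₁ α)) <_) last≡m (inc (inject₁ α) (fromℕ K) inject₁α<K)
          where
            inject₁α<K : inject₁ α Fin.< fromℕ K
            inject₁α<K = ≡.subst (toℕ (inject₁ α) <_) (≡.sym (Fin.toℕ-fromℕ K)) (Fin.inject₁ℕ< α)
        e : Vector (Fin m) K
        e = lowerAll (s ∘ inject₁) init<m
        inc-e : Increasing e
        inc-e = Increasing-lowerAll (s ∘ inject₁) init<m (λ α β α<β → inc (inject₁ α) (inject₁ β)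
                  (≡.subst₂ ℕ._<_ (≡.sym (Fin.toℕ-inject₁ α)) (≡.sym (Fin.toℕ-inject₁ β)) α<β))
        split : (inject₁ ∘ e) ∷ʳ fromℕ m ≗ s
        split = ∷ʳ-ext _ _ s (inject₁-lowerAll (s ∘ inject₁) init<m)
                  (Fin.toℕ-injective (≡.trans (Fin.toℕ-fromℕ m) (≡.sym last≡m)))

  -- The lifted matrix

  zeroRow : ∀ {n} → Fin n → Carrier
  zeroRow _ = 0#

  L⁺-∷ʳ : ∀ {m k} (Y : Mat m k) → ∀ i j → L⁺ Y i j ≡ (Y ∷ʳ zeroRow) i j
  L⁺-∷ʳ {zero}  Y zero    j = ≡.refl
  L⁺-∷ʳ {suc m} Y zero    j = ≡.refl
  L⁺-∷ʳ {suc m} Y (suc i) j = L⁺-∷ʳ (Y ∘ suc) i j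

  ∷ʳ-congₘ : ∀ {m k} {Y Z : Mat m k} (z : Fin k → Carrier) → Y ≈ₘ Z → (Y ∷ʳ z) ≈ₘ (Z ∷ʳ z)
  ∷ʳ-congₘ {Y = Y} {Z} z Y≈Z i j with view i
  ... | ‵fromℕ     rewrite ∷ʳ-fromℕ Y z | ∷ʳ-fromℕ Z z = refl
  ... | ‵inject₁ r rewrite ∷ʳ-inject₁ Y z r | ∷ʳ-inject₁ Z z r = Y≈Z r j

  ⊛-congˡ : ∀ {m l n} {Y Z : Mat m l} (W : Mat l n) → Y ≈ₘ Z → (Y ⊛ W) ≈ₘ (Z ⊛ W)
  ⊛-congˡ W Y≈Z i j = ∑-cong (λ r → *-congʳ (Y≈Z i r))

  ∷ʳzeroRow-⊛ : ∀ {m l n} (Y : Mat m l) (W : Mat l n) → ((Y ∷ʳ zeroRow) ⊛ W) ≈ₘ ((Y ⊛ W) ∷ʳ zeroRow)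
  ∷ʳzeroRow-⊛ {l = l} Y W i j with view i
  ... | ‵fromℕ     rewrite ∷ʳ-fromℕ Y zeroRow | ∷ʳ-fromℕ (Y ⊛ W) zeroRow =
    trans (∑-cong (λ r → zeroˡ (W r j))) (∑-0 {l})
  ... | ‵inject₁ r rewrite ∷ʳ-inject₁ Y zeroRow r | ∷ʳ-inject₁ (Y ⊛ W) zeroRow r = refl

  module Lift {m : ℕ} (A′ : Mat m m) where

    Â : Mat m (suc m)
    Â i = A′ i ∷ʳ (- ∑ (A′ i))

    lift : Mat (suc m) (suc m)
    lift = Â ∷ʳ zeroRow

    ⊛-L⁻ : ∀ {k} (X : Mat (suc m) k) → (A′ ⊛ L⁻ X) ≈ₘ (Â ⊛ X)
    ⊛-L⁻ X i t = begin
      ∑ (λ r → A′ i r * (X (inject₁ r) t - X (fromℕ m) t))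
        ≈⟨ ∑-cong (λ r → x[y-z]≈xy-xz (A′ i r) _ _) ⟩
      ∑ (λ r → A′ i r * X (inject₁ r) t - A′ i r * X (fromℕ m) t)
        ≈⟨ ∑-+ (λ r → A′ i r * X (inject₁ r) t) (λ r → - (A′ i r * X (fromℕ m) t)) ⟩
      ∑ (λ r → A′ i r * X (inject₁ r) t) + ∑ (λ r → - (A′ i r * X (fromℕ m) t))
        ≈⟨ +-congˡ (∑-neg (λ r → A′ i r * X (fromℕ m) t)) ⟩
      ∑ (λ r → A′ i r * X (inject₁ r) t) - ∑ (λ r → A′ i r * X (fromℕ m) t)
        ≈⟨ +-congˡ (-‿cong (∑-*ʳ (X (fromℕ m) t) (A′ i))) ⟨
      ∑ (λ r → A′ i r * X (inject₁ r) t) - ∑ (A′ i) * X (fromℕ m) t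
        ≈⟨ +-cong (∑-cong (λ r → *-congʳ (reflexive (≡.sym (∷ʳ-inject₁ (A′ i) (- ∑ (A′ i)) r)))))
                  (trans (-‿distribˡ-* _ _) (*-congʳ (reflexive (≡.sym (∷ʳ-fromℕ (A′ i) (- ∑ (A′ i))))))) ⟩
      ∑ (λ r → Â i (inject₁ r) * X (inject₁ r) t) + Â i (fromℕ m) * X (fromℕ m) t
        ≈⟨ ∑-last (λ q → Â i q * X q t) ⟨
      ∑ (λ q → Â i q * X q t)
        ∎

    L⁺∘S∘L⁻≈lift : ∀ {k} (S : Mat m k → Mat m k) (B′ : Mat k k) → (∀ Y → S Y ≈ₘ ((A′ ⊛ Y) ⊛ B′)) →
                   ∀ X → L⁺ (S (L⁻ X)) ≈ₘ ((lift ⊛ X) ⊛ B′)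
    L⁺∘S∘L⁻≈lift S B′ S≈ X i j = begin
      L⁺ (S (L⁻ X)) i j
        ≡⟨ L⁺-∷ʳ (S (L⁻ X)) i j ⟩
      (S (L⁻ X) ∷ʳ zeroRow) i j
        ≈⟨ ∷ʳ-congₘ zeroRow (λ r t → trans (S≈ (L⁻ X) r t) (⊛-congˡ B′ (⊛-L⁻ X) r t)) i j ⟩
      (((Â ⊛ X) ⊛ B′) ∷ʳ zeroRow) i j
        ≈⟨ ∷ʳzeroRow-⊛ (Â ⊛ X) B′ i j ⟨
      (((Â ⊛ X) ∷ʳ zeroRow) ⊛ B′) i j
        ≈⟨ ⊛-congˡ B′ (λ r t → sym (∷ʳzeroRow-⊛ Â X r t)) i j ⟩
      ((lift ⊛ X) ⊛ B′) i j
        ∎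

    module _ {K : ℕ} (B′ : Mat (suc K) (suc K))
      (H : ∀ (d : Fin (suc K) → Fin m) → Increasing d →
             (detC m (suc K) (cols A′ d) * det (suc K) B′) ≈ sgnSet d)
      where

      minor : Vector (Fin (suc m)) (suc K) → Carrier
      minor s = detC m (suc K) (cols Â s) * det (suc K) B′

      minor-alternating : Alternating minor
      minor-alternating = record
        { cong     = λ s≗t → *-congʳ (detC-cong m (suc K) (λ i α → reflexive (≡.cong (Â i) (s≗t α))))
        ; swap     = λ α s → trans (*-congʳ (detC-swap m K α (cols Â s))) (sym (-‿distribˡ-* _ _))
        ; adjacent = λ α s eq →
            trans (*-congʳ (detC-repeatedColumn m K α (cols Â s) (λ i → ≡.cong (Â i) eq))) (zeroˡ _)
        }

      minor-inject₁ : ∀ s → Increasing s → minor (inject₁ ∘ s) ≈ sgnSet s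
      minor-inject₁ s inc =
        trans (*-congʳ (detC-cong m (suc K) (λ i α → reflexive (∷ʳ-inject₁ (A′ i) (- ∑ (A′ i)) (s α)))))
              (H s inc)

      minor-last : ∀ e → minor (e ∷ʳ fromℕ m) ≈ - ∑ (λ r → minor (e ∷ʳ inject₁ r))
      minor-last e = begin
        detC m (suc K) (cols Â (e ∷ʳ fromℕ m)) * detB′
          ≈⟨ *-congʳ (detC-linear m (suc K) (fromℕ K) (λ _ → - 1#) (cols Â (e ∷ʳ fromℕ m)) Y column others) ⟩
        ∑ (λ r → - 1# * detC m (suc K) (Y r)) * detB′
          ≈⟨ *-congʳ (∑-cong {n = m} (λ r → -1*x≈-x _)) ⟩
        ∑ (λ r → - detC m (suc K) (Y r)) * detB′
          ≈⟨ *-congʳ (∑-neg (λ r → detC m (suc K) (Y r))) ⟩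
        - ∑ (λ r → detC m (suc K) (Y r)) * detB′
          ≈⟨ -‿distribˡ-* _ _ ⟨
        - (∑ (λ r → detC m (suc K) (Y r)) * detB′)
          ≈⟨ -‿cong (∑-*ʳ detB′ (λ r → detC m (suc K) (Y r))) ⟩
        - ∑ (λ r → minor (e ∷ʳ inject₁ r))
          ∎
        where
          detB′ = det (suc K) B′
          Y : Fin m → Mat m (suc K)
          Y r = cols Â (e ∷ʳ inject₁ r)
          column : ∀ i → Â i ((e ∷ʳ fromℕ m) (fromℕ K)) ≈ ∑ (λ r → - 1# * Y r i (fromℕ K))
          column i = begin
            Â i ((e ∷ʳ fromℕ m) (fromℕ K))    ≡⟨ ≡.cong (Â i) (∷ʳ-fromℕ e (fromℕ m)) ⟩
            Â i (fromℕ m)                     ≡⟨ ∷ʳ-fromℕ (A′ i) (- ∑ (A′ i)) ⟩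
            - ∑ (A′ i)                        ≈⟨ -1*x≈-x _ ⟨
            - 1# * ∑ (A′ i)                   ≈⟨ ∑-*ˡ (- 1#) (A′ i) ⟩
            ∑ (λ r → - 1# * A′ i r)           ≈⟨ ∑-cong (λ r → *-congˡ (reflexive (≡.sym (Y-last r i)))) ⟩
            ∑ (λ r → - 1# * Y r i (fromℕ K))  ∎
            where
              Y-last : ∀ r i → Y r i (fromℕ K) ≡ A′ i r
              Y-last r i = ≡.trans (≡.cong (Â i) (∷ʳ-fromℕ e (inject₁ r))) (∷ʳ-inject₁ (A′ i) (- ∑ (A′ i)) r)
          others : ∀ r i γ → γ ≢ fromℕ K → Â i ((e ∷ʳ fromℕ m) γ) ≈ Y r i γ
          others r i γ γ≢K with view γ
          ... | ‵fromℕ     = contradiction ≡.refl γ≢K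
          ... | ‵inject₁ j rewrite ∷ʳ-inject₁ e (fromℕ m) j | ∷ʳ-inject₁ e (inject₁ r) j = refl

      detC-cols-lift : (suc m +ℕ suc K) % 2 ≡ 1 → ∀ (d : Fin (suc K) → Fin (suc m)) → Increasing d →
                       (detC (suc m) (suc K) (cols lift d) * det (suc K) B′) ≈ sgnSet d
      detC-cols-lift odd d inc = begin
        detC (suc m) (suc K) (cols lift d) * det (suc K) B′
          ≈⟨ *-congʳ (detC-zeroLastRow m (suc K) (cols lift d) lastRow≈0) ⟩
        detC m (suc K) (cols lift d ∘ inject₁) * det (suc K) B′
          ≈⟨ *-congʳ (detC-cong m (suc K) (λ i α → reflexive (≡.cong (_$ d α) (∷ʳ-inject₁ Â zeroRow i)))) ⟩
        minor d
          ≈⟨ SgnSetExtension.extension minor-alternating minor-inject₁ minor-last odd d inc ⟩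
        sgnSet d
          ∎
        where
          lastRow≈0 : ∀ α → lift (fromℕ m) (d α) ≈ 0#
          lastRow≈0 α = reflexive (≡.cong (_$ d α) (∷ʳ-fromℕ Â zeroRow))

lemma4p11 : {c ℓ : Level} (F : Field c ℓ) → let open FieldDefs F in
    (m k : ℕ) →
    Σ (Fin (suc k) → Carrier) (λ f → ∀ i j → f i ≈ f j → i ≡ j) →
    1 ≤ k → k < suc m → (suc m +ℕ k) % 2 ≡ 1 →
    (S : Mat m k → Mat m k) → IsLinear S →
    (A′ : Mat m m) (B′ : Mat k k) →
    (∀ (d : Fin k → Fin m) → Increasing d → (detC m k (cols A′ d) * det k B′) ≈ sgnSet d) →
    (∀ Y → S Y ≈ₘ ((A′ ⊛ Y) ⊛ B′)) →
    Σ (Mat (suc m) (suc m)) λ A → Σ (Mat k k) λ B →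
      (∀ (d : Fin k → Fin (suc m)) → Increasing d → (detC (suc m) k (cols A d) * det k B) ≈ sgnSet d)
      × (∀ X → L⁺ (S (L⁻ X)) ≈ₘ ((A ⊛ X) ⊛ B))
lemma4p11 F m zero    _ () _ _ _ _ _ _ _ _
lemma4p11 F m (suc K) _ _  _ odd S _ A′ B′ H S≈ =
  lift , B′ , detC-cols-lift B′ H odd , L⁺∘S∘L⁻≈lift S B′ S≈
  where open Lift F A′
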